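{- Let $A$ be a finite set of atoms, let $\ell, r$ be hedges or individual terms and $\nabla$ a freshness context, all $A$-based. Let $X$ be a hedge variable occurring neither in $\ell$, $r$ nor $\nabla$. If $\{X\colon \ell\triangleq r\};\,\emptyset;\,\emptyset;\,id\overset{+}{\Longrightarrow}\emptyset;\,S;\,\Gamma;\,\sigma$ is a derivation (of length at least one) obtained by an execution of the algorithm $\mathsf{VNAU}$ with global parameters $A$ and $\nabla$, then $\langle\Gamma\vdash X\sigma\rangle$ is an $A$-based generalization of $\langle\nabla\vdash\ell\rangle$ and $\langle\nabla\vdash r\rangle$.
   Context: Signature: four pairwise disjoint sets: a countably infinite set of atoms $\mathbf{A}=\{a,b,c,\dots\}$, a countable set of variadic function symbols $\{f,g,h,\dots\}$, a countably infinite set of individual variables $\{x,y,z,\dots\}$ and a countably infinite set of hedge variables $\{X,Y,Z,\dots\}$; $\chi$ denotes a variable of either kind. Permutations $\pi$ of atoms have finite support $\mathrm{supp}(\pi)=\{a\mid \pi(a)\neq a\}$ and are written as finite sequences of swappings $(a\,b)$; $\mathit{Id}$ is the identity. Terms are individual terms $t::= a \mid \pi\cdot x \mid a.t \mid f(\tilde s)$, and hedges $\tilde s ::= r_1,\dots,r_n$ ($n\ge 0$) with $r::=\pi\cdot X\mid t$. Hedges are flat, a singleton hedge is identified with its element, $\varepsilon$ is the empty hedge, $|\tilde s|$ is the length. $\pi\cdot x$, $\pi\cdot X$ are suspensions; $\chi$ abbreviates $\mathit{Id}\cdot\chi$. Permutations act on terms: $(a\,b)\cdot a=b$, $(a\,b)\cdot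 b=a$, $(a\,b)\cdot c=c$ for $c\notin\{a,b\}$, $(a\,b)\cdot(\pi\cdot\chi)=((a\,b)\pi)\cdot\chi$, $(a\,b)\cdot(c.t)=((a\,b)\cdot c).((a\,b)\cdot t)$, $(a\,b)\cdot f(\tilde s)=f((a\,b)\cdot\tilde s)$, componentwise on hedges; a sequence of swappings acts from right to left. Heads: $\mathrm{head}(a)=a$, $\mathrm{head}(\pi\cdot\chi)=\chi$, $\mathrm{head}(a.t)=\text{``.''}$, $\mathrm{head}(f(\tilde s))=f$. Substitutions are finite maps from variables to terms (individual variables to individual terms), identity elsewhere; $id$ is the empty substitution; application: $a\sigma=a$, $(\pi\cdot\chi)\sigma=\pi\cdot(\chi\sigma)$, $(a.t)\sigma=a.(t\sigma)$, $f(\tilde s)\sigma=f(\tilde s\sigma)$, componentwise on hedges. $\sigma\{\chi\mapsto u\}$ is composition of $\sigma$ followed by $\{\chi\mapsto u\}$. A freshness context is a finite set of constraints $a\#\chi$. $\nabla\vdash a\# u$: $\nabla\vdash a\#b$ if $a\ne b$; $\nabla\vdash a\#f(\tilde s)$ if $\nabla\vdash a\#\tilde s$; $\nabla\vdash a\#(r_1,\dots,r_n)$ if $\nabla\vdash a\#r_i$ for all $i$; $\nabla\vdash a\#a.t$; $\nabla\vdash a\#b.t$ if $a\neq b$ and $\nabla\vdash a\#t$; $\nabla\vdash a\#\pi\cdot\chi$ if $(\pi^{ -1}\cdot a)\#\chi\in\nabla$. A substitution $\sigma$ respects $\nabla$ if $\nabla\vdash a\#\chi\sigma$ for all $a\#\chi\in\nabla$;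 then $\nabla\sigma$ is the smallest freshness context $\Gamma$ with $\Gamma\vdash a\#\chi\sigma$ for all $a\#\chi\in\nabla$ (also written $\Gamma\{\chi\mapsto u\}$ for a single assignment). The equivalence $\nabla\vdash u\approx u'$: $a\approx a$; $f(\tilde s)\approx f(\tilde q)$ if $\tilde s\approx\tilde q$; hedges of equal length componentwise; $a.t\approx a.t'$ if $t\approx t'$; $a.t\approx b.t'$ if $t\approx (a\,b)\cdot t'$ and $\nabla\vdash a\#b.t'$; $\pi\cdot\chi\approx\pi'\cdot\chi$ if $a\#\chi\in\nabla$ for all $a$ with $\pi\cdot a\neq\pi'\cdot a$. A term-in-context is a pair $\langle\nabla\vdash u\rangle$. $\langle\nabla_1\vdash u_1\rangle$ is more general than $\langle\nabla_2\vdash u_2\rangle$ if there is a substitution $\sigma$ respecting $\nabla_1$ with $\nabla_1\sigma\subseteq\nabla_2$ and $\nabla_2\vdash u_1\sigma\approx u_2$. A generalization of two terms-in-context is a term-in-context more general than both. Something is $A$-based if all atoms occurring in it (including supports of permutations in suspensions, atoms in freshness constraints) belong to $A$. The algorithm $\mathsf{VNAU}$ (global parameters: finite $A\subset\mathbf{A}$ and freshness context $\nabla$) works on states $P;\,S;\,\Gamma;\,\sigma$ with $P$, $S$ sets of anti-unification problems (AUPs) $\chi\colon \ell\triangleq r$, $\Gamma$ a freshness context, $\sigma$ a substitution; it applies the following rules exhaustively in all possible ways. "New" variables occur neither in the state nor in the parameters; $\dot\cup$ is disjoint union. Rules: (Tri-T) $\{X\colon a\triangleq a\}\dot\cup P;S;\Gamma;\sigma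 \Rightarrow P;S;\Gamma;\sigma\{X\mapsto a\}$. (Tri-H) $\{X\colon \varepsilon\triangleq\varepsilon\}\dot\cup P;S;\Gamma;\sigma\Rightarrow P;S;\Gamma;\sigma\{X\mapsto\varepsilon\}$. (Dec-T) $\{X\colon f(\tilde s)\triangleq f(\tilde q)\}\dot\cup P;S;\Gamma;\sigma\Rightarrow\{Y\colon\tilde s\triangleq\tilde q\}\cup P;S;\Gamma;\sigma\{X\mapsto f(Y)\}$, $Y$ a new hedge variable. (Dec-H) $\{X\colon \tilde s_1,\tilde s_2\triangleq\tilde q_1,\tilde q_2\}\dot\cup P;S;\Gamma;\sigma\Rightarrow\{Y_1\colon\tilde s_1\triangleq\tilde q_1, Y_2\colon\tilde s_2\triangleq\tilde q_2\}\cup P;S;\Gamma;\sigma\{X\mapsto Y_1,Y_2\}$, where $|\tilde s_1,\tilde q_1|=1$ or $|\tilde s_1|=|\tilde q_1|=1$, $|\tilde s_2,\tilde q_2|\ge 1$, $Y_1,Y_2$ new hedge variables. (Abs-T) $\{X\colon a.t_1\triangleq b.t_2\}\dot\cup P;S;\Gamma;\sigma\Rightarrow\{Y\colon (c\,a)\cdot t_1\triangleq (c\,b)\cdot t_2\}\cup P;S;\Gamma;\sigma\{X\mapsto c.Y\}$, where $c\in A$, $Y$ new hedge variable, $\nabla\vdash c\#a.t_1$ and $\nabla\vdash c\#b.t_2$. (Sol-T) $\{X\colon r_1\triangleq r_2\}\dot\cup P;S;\Gamma;\sigma\Rightarrow P;\{X\colon r_1\triangleq r_2\}\cup S;\{a\#X\mid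 a\in A,\nabla\vdash a\#r_1,\nabla\vdash a\#r_2\}\cup\Gamma;\sigma$, where $r_1,r_2$ are suspensions or $\mathrm{head}(r_1)\ne\mathrm{head}(r_2)$. (Sol-H) $\{X\colon \tilde s\triangleq\tilde q\}\dot\cup P;S;\Gamma;\sigma\Rightarrow P;\{X\colon\tilde s\triangleq\tilde q\}\cup S;\{a\#X\mid a\in A,\nabla\vdash a\#\tilde s,\nabla\vdash a\#\tilde q\}\cup\Gamma;\sigma$, where $|\tilde s,\tilde q|=1$. (Mer) $P;\{\chi_1\colon\ell_1\triangleq r_1,\chi_2\colon\ell_2\triangleq r_2\}\dot\cup S;\Gamma;\sigma\Rightarrow P;\{\chi_1\colon\ell_1\triangleq r_1\}\cup S;\Gamma\{\chi_2\mapsto\pi\cdot\chi_1\};\sigma\{\chi_2\mapsto\pi\cdot\chi_1\}$, where $\pi$ is an $A$-based permutation with $\nabla\vdash\pi\cdot\ell_1\approx\ell_2$ and $\nabla\vdash\pi\cdot r_1\approx r_2$. (Nar-T) $P;\{X\colon t_1\triangleq t_2\}\dot\cup S;\Gamma;\sigma\Rightarrow P;\{x\colon t_1\triangleq t_2\}\cup S;\Gamma\{X\mapsto x\};\sigma\{X\mapsto x\}$ ($t_1,t_2$ individual terms, $x$ new individual variable). -}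

module Defs where

open import Data.Nat using (ℕ; _≡ᵇ_; _+_; _≥_)
open import Data.Bool using (if_then_else_)
open import Data.List using (List; []; _∷_; _++_; [_]; length; reverse; foldr; concatMap; map)
open import Data.List.Membership.Propositional using (_∈_; _∉_)
open import Data.List.Relation.Unary.All using (All)
open import Data.List.Relation.Binary.Permutation.Propositional using (_↭_)
open import Data.List.Relation.Binary.Subset.Propositional using (_⊆_)
open import Data.Product using (Σ; _×_; _,_; proj₁; proj₂)
open import Data.Sum using (_⊎_)
open import Data.Maybe using (Maybe; just; nothing; maybe)
open import Data.Empty using (⊥)
open import Data.Unit using (⊤)
open import Relation.Binary.PropositionalEquality using (_≡_; _≢_)
open import Relation.Binary.Construct.Closure.Transitive using (TransClosure)

Atom : Set
Atom = ℕ

FSym : Set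
FSym = ℕ

IVar : Set
IVar = ℕ

HVar : Set
HVar = ℕ

data Var : Set where
  ivar : IVar → Var
  hvar : HVar → Var

Perm : Set
Perm = List (Atom × Atom)

Id : Perm
Id = []

swap : Atom → Atom → Atom → Atom
swap a b c = if c ≡ᵇ a then b else (if c ≡ᵇ b then a else c)

-- π · c   (the sequence (a1 b1)(a2 b2)…(an bn) acts from right to left)
_∙ₐ_ : Perm → Atom → Atom
π ∙ₐ c = foldr (λ p d → swap (proj₁ p) (proj₂ p) d) c π

inv : Perm → Perm
inv = reverse

-- Hedges are flat lists of elements r ::= π·X | t;
-- an individual term / singleton hedge is a one-element list.
-- The body of an abstraction is stored as a hedge, because the
-- algorithm produces c.Y with Y a hedge variable (rule Abs-T); for the
-- paper's terms the body is a singleton individual term (see WFE).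

data Elem : Set where
  atom  : Atom → Elem
  isusp : Perm → IVar → Elem
  hsusp : Perm → HVar → Elem
  abs   : Atom → List Elem → Elem
  app   : FSym → List Elem → Elem

Hedge : Set
Hedge = List Elem

IsIndiv : Elem → Set
IsIndiv (hsusp _ _) = ⊥
IsIndiv _ = ⊤

IsSusp : Elem → Set
IsSusp (isusp _ _) = ⊤
IsSusp (hsusp _ _) = ⊤
IsSusp _ = ⊥

mutual
  WFE : Elem → Set
  WFE (atom _) = ⊤
  WFE (isusp _ _) = ⊤
  WFE (hsusp _ _) = ⊤
  WFE (abs _ []) = ⊥
  WFE (abs _ (t ∷ [])) = IsIndiv t × WFE t
  WFE (abs _ (_ ∷ _ ∷ _)) = ⊥
  WFE (app _ h) = WFH h

  WFH : Hedge → Set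
  WFH [] = ⊤
  WFH (e ∷ h) = WFE e × WFH h

data Head : Set where
  hAtom : Atom → Head
  hVar  : Var → Head
  hDot  : Head
  hFun  : FSym → Head

head : Elem → Head
head (atom a) = hAtom a
head (isusp _ x) = hVar (ivar x)
head (hsusp _ X) = hVar (hvar X)
head (abs _ _) = hDot
head (app f _) = hFun f

mutual
  permE : Perm → Elem → Elem
  permE π (atom a) = atom (π ∙ₐ a)
  permE π (isusp π' x) = isusp (π ++ π') x
  permE π (hsusp π' X) = hsusp (π ++ π') X
  permE π (abs a h) = abs (π ∙ₐ a) (permH π h)
  permE π (app f h) = app f (permH π h)

  permH : Perm → Hedge → Hedge
  permH π [] = []
  permH π (e ∷ h) = permE π e ∷ permH π h

susp : Perm → Var → Elem
susp π (ivar x) = isusp π x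
susp π (hvar X) = hsusp π X

varTerm : Var → Hedge
varTerm χ = [ susp Id χ ]

Ctx : Set
Ctx = List (Atom × Var)

mutual
  FreshE : Ctx → Atom → Elem → Set
  FreshE ∇ a (atom b) = a ≢ b
  FreshE ∇ a (isusp π x) = (inv π ∙ₐ a , ivar x) ∈ ∇
  FreshE ∇ a (hsusp π X) = (inv π ∙ₐ a , hvar X) ∈ ∇
  FreshE ∇ a (abs b h) = a ≡ b ⊎ (a ≢ b × FreshH ∇ a h)
  FreshE ∇ a (app f h) = FreshH ∇ a h

  FreshH : Ctx → Atom → Hedge → Set
  FreshH ∇ a [] = ⊤
  FreshH ∇ a (e ∷ h) = FreshE ∇ a e × FreshH ∇ a h

mutual
  data _⊢_≈E_ (∇ : Ctx) : Elem → Elem → Set where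
    ≈atom  : ∀ {a} → ∇ ⊢ atom a ≈E atom a
    ≈app   : ∀ {f h h'} → ∇ ⊢ h ≈H h' → ∇ ⊢ app f h ≈E app f h'
    ≈abs=  : ∀ {a h h'} → ∇ ⊢ h ≈H h' → ∇ ⊢ abs a h ≈E abs a h'
    ≈abs   : ∀ {a b h h'} → ∇ ⊢ h ≈H permH ((a , b) ∷ []) h' →
             FreshE ∇ a (abs b h') → ∇ ⊢ abs a h ≈E abs b h'
    ≈isusp : ∀ {π π' x} → (∀ a → π ∙ₐ a ≢ π' ∙ₐ a → (a , ivar x) ∈ ∇) →
             ∇ ⊢ isusp π x ≈E isusp π' x
    ≈hsusp : ∀ {π π' X} → (∀ a → π ∙ₐ a ≢ π' ∙ₐ a → (a , hvar X) ∈ ∇) →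
             ∇ ⊢ hsusp π X ≈E hsusp π' X

  data _⊢_≈H_ (∇ : Ctx) : Hedge → Hedge → Set where
    []  : ∇ ⊢ [] ≈H []
    _∷_ : ∀ {e e' h h'} → ∇ ⊢ e ≈E e' → ∇ ⊢ h ≈H h' → ∇ ⊢ (e ∷ h) ≈H (e' ∷ h')

-- Substitutions: finite maps (lists of bindings, first binding wins)

data Binding : Set where
  _↦ᵢ_ : IVar → Elem → Binding
  _↦ₕ_ : HVar → Hedge → Binding

Subst : Set
Subst = List Binding

idₛ : Subst
idₛ = []

lookupI : Subst → IVar → Maybe Elem
lookupI [] x = nothing
lookupI ((y ↦ᵢ t) ∷ σ) x = if y ≡ᵇ x then just t else lookupI σ x
lookupI ((_ ↦ₕ _) ∷ σ) x = lookupI σ x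

lookupH : Subst → HVar → Maybe Hedge
lookupH [] X = nothing
lookupH ((_ ↦ᵢ _) ∷ σ) X = lookupH σ X
lookupH ((Y ↦ₕ h) ∷ σ) X = if Y ≡ᵇ X then just h else lookupH σ X

WellSorted : Subst → Set
WellSorted σ = All ok σ
  where
    ok : Binding → Set
    ok (_ ↦ᵢ t) = IsIndiv t
    ok (_ ↦ₕ _) = ⊤

mutual
  substI : Subst → Elem → Elem
  substI σ (atom a) = atom a
  substI σ (isusp π x) = maybe (permE π) (isusp π x) (lookupI σ x)
  substI σ (hsusp π X) = hsusp π X   -- never used on individual terms
  substI σ (abs a h) = abs a (substH σ h)
  substI σ (app f h) = app f (substH σ h)

  substH : Subst → Hedge → Hedge
  substH σ [] = []
  substH σ (atom a ∷ h) = substI σ (atom a) ∷ substH σ h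
  substH σ (isusp π x ∷ h) = substI σ (isusp π x) ∷ substH σ h
  substH σ (hsusp π X ∷ h) = maybe (permH π) [ hsusp π X ] (lookupH σ X) ++ substH σ h
  substH σ (abs a b ∷ h) = substI σ (abs a b) ∷ substH σ h
  substH σ (app f b ∷ h) = substI σ (app f b) ∷ substH σ h

substB : Subst → Binding → Binding
substB τ (x ↦ᵢ t) = x ↦ᵢ substI τ t
substB τ (X ↦ₕ h) = X ↦ₕ substH τ h

-- composition: σ followed by τ  (so u (σ ∘ₛ τ) = (u σ) τ)
_∘ₛ_ : Subst → Subst → Subst
σ ∘ₛ τ = map (substB τ) σ ++ τ

-- minimal freshness constraints needed for a # u
mutual
  needsE : Atom → Elem → Ctx
  needsE a (atom b) = []
  needsE a (isusp π x) = [ (inv π ∙ₐ a , ivar x) ]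
  needsE a (hsusp π X) = [ (inv π ∙ₐ a , hvar X) ]
  needsE a (abs b h) = if a ≡ᵇ b then [] else needsH a h
  needsE a (app f h) = needsH a h

  needsH : Atom → Hedge → Ctx
  needsH a [] = []
  needsH a (e ∷ h) = needsE a e ++ needsH a h

-- σ respects ∇ : the constraints a # χσ are jointly satisfiable
Respects : Ctx → Subst → Set
Respects ∇ σ = Σ Ctx λ Γ → ∀ c → c ∈ ∇ → FreshH Γ (proj₁ c) (substH σ (varTerm (proj₂ c)))

-- ∇σ : the smallest Γ with Γ ⊢ a # χσ for all a # χ ∈ ∇
_⟪_⟫ : Ctx → Subst → Ctx
∇ ⟪ σ ⟫ = concatMap (λ c → needsH (proj₁ c) (substH σ (varTerm (proj₂ c)))) ∇

MoreGeneral : Ctx → Hedge → Ctx → Hedge → Set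
MoreGeneral ∇₁ u₁ ∇₂ u₂ =
  Σ Subst λ σ → WellSorted σ × Respects ∇₁ σ × (∇₁ ⟪ σ ⟫ ⊆ ∇₂) × (∇₂ ⊢ substH σ u₁ ≈H u₂)

ABasedPerm : List Atom → Perm → Set
ABasedPerm A π = ∀ a → π ∙ₐ a ≢ a → a ∈ A

mutual
  ABasedE : List Atom → Elem → Set
  ABasedE A (atom a) = a ∈ A
  ABasedE A (isusp π _) = ABasedPerm A π
  ABasedE A (hsusp π _) = ABasedPerm A π
  ABasedE A (abs a h) = a ∈ A × ABasedH A h
  ABasedE A (app _ h) = ABasedH A h

  ABasedH : List Atom → Hedge → Set
  ABasedH A [] = ⊤
  ABasedH A (e ∷ h) = ABasedE A e × ABasedH A h

ABasedCtx : List Atom → Ctx → Set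
ABasedCtx A Γ = All (λ c → proj₁ c ∈ A) Γ

IsABasedGeneralization : List Atom → Ctx → Hedge → Ctx → Hedge → Ctx → Hedge → Set
IsABasedGeneralization A Γ u ∇₁ u₁ ∇₂ u₂ =
  ABasedCtx A Γ × ABasedH A u × MoreGeneral Γ u ∇₁ u₁ × MoreGeneral Γ u ∇₂ u₂

mutual
  varsE : Elem → List Var
  varsE (atom _) = []
  varsE (isusp _ x) = [ ivar x ]
  varsE (hsusp _ X) = [ hvar X ]
  varsE (abs _ h) = varsH h
  varsE (app _ h) = varsH h

  varsH : Hedge → List Var
  varsH [] = []
  varsH (e ∷ h) = varsE e ++ varsH h

varsCtx : Ctx → List Var
varsCtx = map proj₂

varsB : Binding → List Var
varsB (x ↦ᵢ t) = ivar x ∷ varsE t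
varsB (X ↦ₕ h) = hvar X ∷ varsH h

varsSubst : Subst → List Var
varsSubst = concatMap varsB

record AUP : Set where
  constructor _∶_≜_
  field
    var : Var
    lhs : Hedge
    rhs : Hedge

varsAUP : AUP → List Var
varsAUP (χ ∶ l ≜ r) = χ ∷ varsH l ++ varsH r

-- states P; S; Γ; σ  (sets of AUPs represented as lists up to ↭)
record State : Set where
  constructor st
  field
    P : List AUP
    S : List AUP
    Γ : Ctx
    σ : Subst

varsState : State → List Var
varsState (st P S Γ σ) =
  concatMap varsAUP P ++ concatMap varsAUP S ++ varsCtx Γ ++ varsSubst σ

New : Ctx → State → Var → Set
New ∇ s v = v ∉ varsState s × v ∉ varsCtx ∇

-- Γ' = {a # X | a ∈ A, ∇ ⊢ a # l, ∇ ⊢ a # r} ∪ Γ   (as sets)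
SolCtx : List Atom → Ctx → HVar → Hedge → Hedge → Ctx → Ctx → Set
SolCtx A ∇ X l r Γ Γ' = ∀ c →
  (c ∈ Γ' → Q c) × (Q c → c ∈ Γ')
  where
    Q : Atom × Var → Set
    Q c = c ∈ Γ ⊎ Σ Atom λ a → c ≡ (a , hvar X) × a ∈ A × FreshH ∇ a l × FreshH ∇ a r

data MerBind : Var → Perm → Var → Binding → Set where
  mb-h : ∀ {X π χ} → MerBind (hvar X) π χ (X ↦ₕ [ susp π χ ])
  mb-i : ∀ {x π y} → MerBind (ivar x) π (ivar y) (x ↦ᵢ isusp π y)

data Step (A : List Atom) (∇ : Ctx) : State → State → Set where
  tri-T : ∀ {X a P P' S Γ σ} →
    P ↭ (hvar X ∶ [ atom a ] ≜ [ atom a ]) ∷ P' →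
    Step A ∇ (st P S Γ σ) (st P' S Γ (σ ∘ₛ [ X ↦ₕ [ atom a ] ]))
  tri-H : ∀ {X P P' S Γ σ} →
    P ↭ (hvar X ∶ [] ≜ []) ∷ P' →
    Step A ∇ (st P S Γ σ) (st P' S Γ (σ ∘ₛ [ X ↦ₕ [] ]))
  dec-T : ∀ {X f s q Y P P' S Γ σ} →
    P ↭ (hvar X ∶ [ app f s ] ≜ [ app f q ]) ∷ P' →
    New ∇ (st P S Γ σ) (hvar Y) →
    Step A ∇ (st P S Γ σ)
      (st ((hvar Y ∶ s ≜ q) ∷ P') S Γ (σ ∘ₛ [ X ↦ₕ [ app f [ hsusp Id Y ] ] ]))
  dec-H : ∀ {X s₁ s₂ q₁ q₂ Y₁ Y₂ P P' S Γ σ} →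
    P ↭ (hvar X ∶ (s₁ ++ s₂) ≜ (q₁ ++ q₂)) ∷ P' →
    (length s₁ + length q₁ ≡ 1 ⊎ (length s₁ ≡ 1 × length q₁ ≡ 1)) →
    length s₂ + length q₂ ≥ 1 →
    New ∇ (st P S Γ σ) (hvar Y₁) → New ∇ (st P S Γ σ) (hvar Y₂) → Y₁ ≢ Y₂ →
    Step A ∇ (st P S Γ σ)
      (st ((hvar Y₁ ∶ s₁ ≜ q₁) ∷ (hvar Y₂ ∶ s₂ ≜ q₂) ∷ P') S Γ
          (σ ∘ₛ [ X ↦ₕ (hsusp Id Y₁ ∷ hsusp Id Y₂ ∷ []) ]))
  abs-T : ∀ {X a b t₁ t₂ c Y P P' S Γ σ} →
    P ↭ (hvar X ∶ [ abs a t₁ ] ≜ [ abs b t₂ ]) ∷ P' →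
    c ∈ A → FreshE ∇ c (abs a t₁) → FreshE ∇ c (abs b t₂) →
    New ∇ (st P S Γ σ) (hvar Y) →
    Step A ∇ (st P S Γ σ)
      (st ((hvar Y ∶ permH ((c , a) ∷ []) t₁ ≜ permH ((c , b) ∷ []) t₂) ∷ P') S Γ
          (σ ∘ₛ [ X ↦ₕ [ abs c [ hsusp Id Y ] ] ]))
  sol-T : ∀ {X r₁ r₂ P P' S Γ Γ' σ} →
    P ↭ (hvar X ∶ [ r₁ ] ≜ [ r₂ ]) ∷ P' →
    ((IsSusp r₁ × IsSusp r₂) ⊎ head r₁ ≢ head r₂) →
    SolCtx A ∇ X [ r₁ ] [ r₂ ] Γ Γ' →
    Step A ∇ (st P S Γ σ) (st P' ((hvar X ∶ [ r₁ ] ≜ [ r₂ ]) ∷ S) Γ' σ)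
  sol-H : ∀ {X s q P P' S Γ Γ' σ} →
    P ↭ (hvar X ∶ s ≜ q) ∷ P' →
    length s + length q ≡ 1 →
    SolCtx A ∇ X s q Γ Γ' →
    Step A ∇ (st P S Γ σ) (st P' ((hvar X ∶ s ≜ q) ∷ S) Γ' σ)
  mer : ∀ {χ₁ χ₂ ℓ₁ r₁ ℓ₂ r₂ π b P S S' Γ σ} →
    S ↭ (χ₁ ∶ ℓ₁ ≜ r₁) ∷ (χ₂ ∶ ℓ₂ ≜ r₂) ∷ S' →
    ABasedPerm A π →
    ∇ ⊢ permH π ℓ₁ ≈H ℓ₂ → ∇ ⊢ permH π r₁ ≈H r₂ →
    MerBind χ₂ π χ₁ b →
    Step A ∇ (st P S Γ σ) (st P ((χ₁ ∶ ℓ₁ ≜ r₁) ∷ S') (Γ ⟪ [ b ] ⟫) (σ ∘ₛ [ b ]))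
  nar-T : ∀ {X t₁ t₂ x P S S' Γ σ} →
    S ↭ (hvar X ∶ [ t₁ ] ≜ [ t₂ ]) ∷ S' →
    IsIndiv t₁ → IsIndiv t₂ →
    New ∇ (st P S Γ σ) (ivar x) →
    Step A ∇ (st P S Γ σ)
      (st P ((ivar x ∶ [ t₁ ] ≜ [ t₂ ]) ∷ S') (Γ ⟪ [ X ↦ₕ [ isusp Id x ] ] ⟫)
          (σ ∘ₛ [ X ↦ₕ [ isusp Id x ] ]))

_⟹⁺[_,_]_ : State → List Atom → Ctx → State → Set
s ⟹⁺[ A , ∇ ] s' = TransClosure (Step A ∇) s s'

-- Soundness follows from an invariant of the states P; S; Γ; σ reachable from
-- {X : ℓ ≜ r}; ∅; ∅; id.  Its core says that Xσ generalizes ℓ and r with the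
-- variables of the open problems P ∪ S as holes: every substitution mapping the
-- variable of each problem χ : l ≜ q to a hedge ≈ l turns Xσ into a hedge ≈ ℓ,
-- and likewise on the right.  Tri, Dec, Abs and Nar preserve this by
-- substitution composition; Mer needs equivariance and transitivity of ≈, the
-- latter via the disagreement-set lemma.  Moreover every constraint a # χ in Γ
-- is justified by a problem χ : l ≜ q in S with a ∈ A fresh for l and q, and
-- everything stays A-based.  When P is empty, instantiating each problem of S by
-- its left (right) side witnesses that ⟨Γ ⊢ Xσ⟩ is more general than ⟨∇ ⊢ ℓ⟩
-- (⟨∇ ⊢ r⟩).

module Submission where

open import Defs
open import Data.Nat using (zero; suc; _≡ᵇ_; _≟_)
open import Data.Nat.Properties using (≡ᵇ⇒≡)
open import Data.Bool using (true; false)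
open import Data.List using (List; []; _∷_; _++_; [_]; reverse; concatMap)
open import Data.List.Properties using (unfold-reverse; ++-assoc; ++-identityʳ)
open import Data.List.Membership.Propositional using (_∈_; _∉_; find)
open import Data.List.Membership.Propositional.Properties using (∈-++⁺ˡ; ∈-++⁺ʳ; ∈-++⁻; ∈-concatMap⁺; ∈-concatMap⁻)
open import Data.List.Relation.Unary.Any as Any using (here; there)
open import Data.List.Relation.Unary.All as All using (All; []; _∷_)
import Data.List.Relation.Unary.All.Properties as Allₚ
open import Data.List.Relation.Unary.AllPairs as AllPairs using (AllPairs; []; _∷_)
import Data.List.Relation.Unary.AllPairs.Properties as AllPairsₚ
open import Data.List.Relation.Binary.Subset.Propositional using (_⊆_)
open import Data.List.Relation.Binary.Permutation.Propositional using (_↭_; ↭-refl; ↭-sym; ↭-trans; ↭-swap; ↭⇒↭ₛ)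
open import Data.List.Relation.Binary.Permutation.Propositional.Properties using (All-resp-↭; ∈-resp-↭; shift; ++⁺ˡ; ++⁺ʳ)
open import Data.Maybe using (just; nothing; maybe)
open import Data.Product using (Σ; _×_; _,_; proj₁; proj₂)
open import Data.Sum using (_⊎_; inj₁; inj₂)
open import Data.Unit using (tt)
open import Relation.Nullary using (Dec; yes; no; contradiction)
open import Relation.Binary.PropositionalEquality as ≡
  using (_≡_; _≢_; refl; sym; trans; cong; cong₂; subst; resp₂; module ≡-Reasoning)
import Relation.Binary.Construct.Closure.Transitive as Plus
open import Data.List.Relation.Binary.Permutation.Setoid.Properties (≡.setoid AUP) using (AllPairs-resp-↭)

-- Permutations

≡ᵇ-refl : ∀ n → (n ≡ᵇ n) ≡ true
≡ᵇ-refl zero    = refl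
≡ᵇ-refl (suc n) = ≡ᵇ-refl n

≢⇒≡ᵇ-false : ∀ {m n} → m ≢ n → (m ≡ᵇ n) ≡ false
≢⇒≡ᵇ-false {m} {n} m≢n with m ≡ᵇ n | ≡ᵇ⇒≡ m n
... | true  | to-≡ = contradiction (to-≡ _) m≢n
... | false | _     = refl

swap-left : ∀ a b → swap a b a ≡ b
swap-left a b rewrite ≡ᵇ-refl a = refl

swap-right : ∀ a b → swap a b b ≡ a
swap-right a b with b ≟ a
... | yes refl rewrite ≡ᵇ-refl b = refl
... | no b≢a rewrite ≢⇒≡ᵇ-false b≢a | ≡ᵇ-refl b = refl

swap-other : ∀ {a b c} → c ≢ a → c ≢ b → swap a b c ≡ c
swap-other c≢a c≢b rewrite ≢⇒≡ᵇ-false c≢a | ≢⇒≡ᵇ-false c≢b = refl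

swap-self : ∀ a c → swap a a c ≡ c
swap-self a c with c ≟ a
... | yes refl = swap-left c c
... | no c≢a   = swap-other c≢a c≢a

swap-involutive : ∀ a b c → swap a b (swap a b c) ≡ c
swap-involutive a b c with c ≟ a | c ≟ b
... | yes refl | _        rewrite swap-left c b  = swap-right c b
... | no _     | yes refl rewrite swap-right a c = swap-left a c
... | no c≢a   | no c≢b   rewrite swap-other c≢a c≢b = swap-other c≢a c≢b

∙ₐ-++ : ∀ π ρ a → (π ++ ρ) ∙ₐ a ≡ π ∙ₐ (ρ ∙ₐ a)
∙ₐ-++ []      ρ a = refl
∙ₐ-++ (p ∷ π) ρ a = cong (swap (proj₁ p) (proj₂ p)) (∙ₐ-++ π ρ a)

inv-inverseˡ : ∀ π a → inv π ∙ₐ (π ∙ₐ a) ≡ a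
inv-inverseˡ []            a = refl
inv-inverseˡ ((b , c) ∷ π) a = begin
  inv ((b , c) ∷ π) ∙ₐ swap b c (π ∙ₐ a)
    ≡⟨ cong (_∙ₐ swap b c (π ∙ₐ a)) (unfold-reverse (b , c) π) ⟩
  (inv π ++ [ (b , c) ]) ∙ₐ swap b c (π ∙ₐ a)
    ≡⟨ ∙ₐ-++ (inv π) _ _ ⟩
  inv π ∙ₐ swap b c (swap b c (π ∙ₐ a))
    ≡⟨ cong (inv π ∙ₐ_) (swap-involutive b c _) ⟩
  inv π ∙ₐ (π ∙ₐ a)
    ≡⟨ inv-inverseˡ π a ⟩
  a ∎
  where open ≡-Reasoning

inv-inverseʳ : ∀ π a → π ∙ₐ (inv π ∙ₐ a) ≡ a
inv-inverseʳ []            a = refl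
inv-inverseʳ ((b , c) ∷ π) a = begin
  swap b c (π ∙ₐ (inv ((b , c) ∷ π) ∙ₐ a))
    ≡⟨ cong (λ ρ → swap b c (π ∙ₐ (ρ ∙ₐ a))) (unfold-reverse (b , c) π) ⟩
  swap b c (π ∙ₐ ((inv π ++ [ (b , c) ]) ∙ₐ a))
    ≡⟨ cong (λ d → swap b c (π ∙ₐ d)) (∙ₐ-++ (inv π) _ a) ⟩
  swap b c (π ∙ₐ (inv π ∙ₐ swap b c a))
    ≡⟨ cong (swap b c) (inv-inverseʳ π _) ⟩
  swap b c (swap b c a)
    ≡⟨ swap-involutive b c a ⟩
  a ∎
  where open ≡-Reasoning

∙ₐ-compose : ∀ π ρ {a b c} → b ≡ π ∙ₐ a → c ≡ ρ ∙ₐ b → c ≡ (ρ ++ π) ∙ₐ a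
∙ₐ-compose π ρ {a} refl refl = sym (∙ₐ-++ ρ π a)

inv-transpose : ∀ π {a b} → π ∙ₐ a ≡ b → a ≡ inv π ∙ₐ b
inv-transpose π {a} πa≡b = trans (sym (inv-inverseˡ π a)) (cong (inv π ∙ₐ_) πa≡b)

∙ₐ-injective : ∀ π {a b} → π ∙ₐ a ≡ π ∙ₐ b → a ≡ b
∙ₐ-injective π {a} {b} eq = trans (inv-transpose π eq) (inv-inverseˡ π b)

∙ₐ-preserves-≢ : ∀ π {a b} → a ≢ b → π ∙ₐ a ≢ π ∙ₐ b
∙ₐ-preserves-≢ π a≢b eq = a≢b (∙ₐ-injective π eq)

swap-equivariant : ∀ π a b c → swap (π ∙ₐ a) (π ∙ₐ b) (π ∙ₐ c) ≡ π ∙ₐ swap a b c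
swap-equivariant π a b c with c ≟ a | c ≟ b
... | yes refl | _        rewrite swap-left (π ∙ₐ c) (π ∙ₐ b) | swap-left c b = refl
... | no _     | yes refl rewrite swap-right (π ∙ₐ a) (π ∙ₐ c) | swap-right a c = refl
... | no c≢a   | no c≢b
  rewrite swap-other (∙ₐ-preserves-≢ π c≢a) (∙ₐ-preserves-≢ π c≢b) | swap-other c≢a c≢b = refl

-- The permutation action on terms

-- ActE π u u' says that u' is π · u.  Permutations are lists of swappings, so
-- the suspensions of u' are only required to agree with those of permE π u
-- extensionally.
mutual
  data ActE (π : Perm) : Elem → Elem → Set where
    act-atom  : ∀ {a b} → b ≡ π ∙ₐ a → ActE π (atom a) (atom b)
    act-isusp : ∀ {ρ ρ' x} → (∀ c → ρ' ∙ₐ c ≡ π ∙ₐ (ρ ∙ₐ c)) → ActE π (isusp ρ x) (isusp ρ' x)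
    act-hsusp : ∀ {ρ ρ' X} → (∀ c → ρ' ∙ₐ c ≡ π ∙ₐ (ρ ∙ₐ c)) → ActE π (hsusp ρ X) (hsusp ρ' X)
    act-abs   : ∀ {a b h h'} → b ≡ π ∙ₐ a → ActH π h h' → ActE π (abs a h) (abs b h')
    act-app   : ∀ {f h h'} → ActH π h h' → ActE π (app f h) (app f h')

  data ActH (π : Perm) : Hedge → Hedge → Set where
    []  : ActH π [] []
    _∷_ : ∀ {e e' h h'} → ActE π e e' → ActH π h h' → ActH π (e ∷ h) (e' ∷ h')

mutual
  act-permE : ∀ π e → ActE π e (permE π e)
  act-permE π (atom a)    = act-atom refl
  act-permE π (isusp ρ x) = act-isusp (∙ₐ-++ π ρ)
  act-permE π (hsusp ρ X) = act-hsusp (∙ₐ-++ π ρ)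
  act-permE π (abs a h)   = act-abs refl (act-permH π h)
  act-permE π (app f h)   = act-app (act-permH π h)

  act-permH : ∀ π h → ActH π h (permH π h)
  act-permH π []      = []
  act-permH π (e ∷ h) = act-permE π e ∷ act-permH π h

mutual
  act-idE : ∀ e → ActE Id e e
  act-idE (atom a)    = act-atom refl
  act-idE (isusp ρ x) = act-isusp (λ _ → refl)
  act-idE (hsusp ρ X) = act-hsusp (λ _ → refl)
  act-idE (abs a h)   = act-abs refl (act-idH h)
  act-idE (app f h)   = act-app (act-idH h)

  act-idH : ∀ h → ActH Id h h
  act-idH []      = []
  act-idH (e ∷ h) = act-idE e ∷ act-idH h

mutual
  act-extE : ∀ {π π' u u'} → (∀ c → π ∙ₐ c ≡ π' ∙ₐ c) → ActE π u u' → ActE π' u u'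
  act-extE π≗π' (act-atom eq)    = act-atom (trans eq (π≗π' _))
  act-extE π≗π' (act-isusp eq)   = act-isusp (λ c → trans (eq c) (π≗π' _))
  act-extE π≗π' (act-hsusp eq)   = act-hsusp (λ c → trans (eq c) (π≗π' _))
  act-extE π≗π' (act-abs eq act) = act-abs (trans eq (π≗π' _)) (act-extH π≗π' act)
  act-extE π≗π' (act-app act)    = act-app (act-extH π≗π' act)

  act-extH : ∀ {π π' u u'} → (∀ c → π ∙ₐ c ≡ π' ∙ₐ c) → ActH π u u' → ActH π' u u'
  act-extH π≗π' []         = []
  act-extH π≗π' (act ∷ as) = act-extE π≗π' act ∷ act-extH π≗π' as

mutual
  act-invE : ∀ {π u u'} → ActE π u u' → ActE (inv π) u' u
  act-invE {π} (act-atom eq)    = act-atom (inv-transpose π (sym eq))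
  act-invE {π} (act-isusp eq)   = act-isusp (λ c → inv-transpose π (sym (eq c)))
  act-invE {π} (act-hsusp eq)   = act-hsusp (λ c → inv-transpose π (sym (eq c)))
  act-invE {π} (act-abs eq act) = act-abs (inv-transpose π (sym eq)) (act-invH act)
  act-invE     (act-app act)    = act-app (act-invH act)

  act-invH : ∀ {π u u'} → ActH π u u' → ActH (inv π) u' u
  act-invH []         = []
  act-invH (act ∷ as) = act-invE act ∷ act-invH as

mutual
  act-∘E : ∀ {π ρ u u' u''} → ActE π u u' → ActE ρ u' u'' → ActE (ρ ++ π) u u''
  act-∘E {π} {ρ} (act-atom eq) (act-atom eq') = act-atom (∙ₐ-compose π ρ eq eq')
  act-∘E {π} {ρ} (act-isusp eq) (act-isusp eq') = act-isusp (λ c → ∙ₐ-compose π ρ (eq c) (eq' c))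
  act-∘E {π} {ρ} (act-hsusp eq) (act-hsusp eq') = act-hsusp (λ c → ∙ₐ-compose π ρ (eq c) (eq' c))
  act-∘E {π} {ρ} (act-abs eq act) (act-abs eq' act') = act-abs (∙ₐ-compose π ρ eq eq') (act-∘H act act')
  act-∘E (act-app act) (act-app act') = act-app (act-∘H act act')

  act-∘H : ∀ {π ρ u u' u''} → ActH π u u' → ActH ρ u' u'' → ActH (ρ ++ π) u u''
  act-∘H []         []           = []
  act-∘H (act ∷ as) (act' ∷ as') = act-∘E act act' ∷ act-∘H as as'

act-conjugate : ∀ {π ρ ρ' g g'} → (∀ c → ρ' ∙ₐ (π ∙ₐ c) ≡ π ∙ₐ (ρ ∙ₐ c)) →
  ActH π g g' → ActH π (permH ρ g) (permH ρ' g')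
act-conjugate {π} {ρ} {ρ'} {g} {g'} ρ'π≗πρ act =
  act-extH ρ'πρ⁻¹≗π (act-∘H (act-∘H (act-invH (act-permH ρ g)) act) (act-permH ρ' g'))
  where
  open ≡-Reasoning
  ρ'πρ⁻¹≗π : ∀ c → (ρ' ++ (π ++ inv ρ)) ∙ₐ c ≡ π ∙ₐ c
  ρ'πρ⁻¹≗π c = begin
    (ρ' ++ (π ++ inv ρ)) ∙ₐ c   ≡⟨ ∙ₐ-++ ρ' _ c ⟩
    ρ' ∙ₐ ((π ++ inv ρ) ∙ₐ c)   ≡⟨ cong (ρ' ∙ₐ_) (∙ₐ-++ π (inv ρ) c) ⟩
    ρ' ∙ₐ (π ∙ₐ (inv ρ ∙ₐ c))   ≡⟨ ρ'π≗πρ (inv ρ ∙ₐ c) ⟩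
    π ∙ₐ (ρ ∙ₐ (inv ρ ∙ₐ c))    ≡⟨ cong (π ∙ₐ_) (inv-inverseʳ ρ c) ⟩
    π ∙ₐ c                      ∎

inv-compose : ∀ π ρ ρ' {a} → (∀ c → ρ' ∙ₐ c ≡ π ∙ₐ (ρ ∙ₐ c)) → inv ρ ∙ₐ a ≡ inv ρ' ∙ₐ (π ∙ₐ a)
inv-compose π ρ ρ' {a} ρ'≗πρ = inv-transpose ρ' (trans (ρ'≗πρ _) (cong (π ∙ₐ_) (inv-inverseʳ ρ a)))

mutual
  fresh-actE : ∀ {∇ a π u u'} → FreshE ∇ a u → ActE π u u' → FreshE ∇ (π ∙ₐ a) u'
  fresh-actE {π = π} a#b (act-atom refl) = ∙ₐ-preserves-≢ π a#b
  fresh-actE {∇} {a} {π} a#x (act-isusp {ρ} {ρ'} {x} eq) =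
    subst (λ c → (c , ivar x) ∈ ∇) (inv-compose π ρ ρ' eq) a#x
  fresh-actE {∇} {a} {π} a#X (act-hsusp {ρ} {ρ'} {X} eq) =
    subst (λ c → (c , hvar X) ∈ ∇) (inv-compose π ρ ρ' eq) a#X
  fresh-actE (inj₁ refl) (act-abs refl _) = inj₁ refl
  fresh-actE {π = π} (inj₂ (a≢b , a#h)) (act-abs refl act) =
    inj₂ (∙ₐ-preserves-≢ π a≢b , fresh-actH a#h act)
  fresh-actE a#h (act-app act) = fresh-actH a#h act

  fresh-actH : ∀ {∇ a π u u'} → FreshH ∇ a u → ActH π u u' → FreshH ∇ (π ∙ₐ a) u'
  fresh-actH _ [] = _
  fresh-actH (a#e , a#h) (act ∷ as) = fresh-actE a#e act , fresh-actH a#h as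

fresh-permH : ∀ {∇ a} π {g} → FreshH ∇ a g → FreshH ∇ (π ∙ₐ a) (permH π g)
fresh-permH π {g} a#g = fresh-actH a#g (act-permH π g)

fresh-act⁻H : ∀ {∇ b π u u'} → FreshH ∇ b u' → ActH π u u' → FreshH ∇ (inv π ∙ₐ b) u
fresh-act⁻H b#u' act = fresh-actH b#u' (act-invH act)

fresh-unpermH : ∀ {∇ a} π {g} → FreshH ∇ a (permH π g) → FreshH ∇ (inv π ∙ₐ a) g
fresh-unpermH π {g} a#πg = fresh-act⁻H a#πg (act-permH π g)

-- Freshness and α-equivalence

fresh-abs-body : ∀ {∇ c a h} → c ≢ a → FreshE ∇ c (abs a h) → FreshH ∇ c h
fresh-abs-body c≢a (inj₁ c≡a)       = contradiction c≡a c≢a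
fresh-abs-body _   (inj₂ (_ , c#h)) = c#h

mutual
  ≈-reflE : ∀ {∇} e → ∇ ⊢ e ≈E e
  ≈-reflE (atom a)    = ≈atom
  ≈-reflE (isusp π x) = ≈isusp (λ _ ne → contradiction refl ne)
  ≈-reflE (hsusp π X) = ≈hsusp (λ _ ne → contradiction refl ne)
  ≈-reflE (abs a h)   = ≈abs= (≈-reflH h)
  ≈-reflE (app f h)   = ≈app (≈-reflH h)

  ≈-reflH : ∀ {∇} h → ∇ ⊢ h ≈H h
  ≈-reflH []      = []
  ≈-reflH (e ∷ h) = ≈-reflE e ∷ ≈-reflH h

≈-++ : ∀ {∇ h₁ h₂ g₁ g₂} → ∇ ⊢ h₁ ≈H g₁ → ∇ ⊢ h₂ ≈H g₂ → ∇ ⊢ (h₁ ++ h₂) ≈H (g₁ ++ g₂)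
≈-++ []       d = d
≈-++ (d₁ ∷ ds) d = d₁ ∷ ≈-++ ds d

mutual
  ≈-actE : ∀ {∇ π e g e' g'} → ∇ ⊢ e ≈E g → ActE π e e' → ActE π g g' → ∇ ⊢ e' ≈E g'
  ≈-actE ≈atom (act-atom refl) (act-atom refl) = ≈atom
  ≈-actE (≈app d) (act-app act) (act-app act') = ≈app (≈-actH d act act')
  ≈-actE (≈abs= d) (act-abs refl act) (act-abs refl act') = ≈abs= (≈-actH d act act')
  ≈-actE {π = π} (≈abs {a} {b} d a#bg) (act-abs refl act) (act-abs refl act') =
    ≈abs (≈-actH d act (act-conjugate (swap-equivariant π a b) act'))
         (fresh-actE a#bg (act-abs refl act'))
  ≈-actE {π = π} (≈isusp ds#) (act-isusp eq) (act-isusp eq') =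
    ≈isusp (λ c ne → ds# c (λ ρc≡ρ'c → ne (trans (eq c) (trans (cong (π ∙ₐ_) ρc≡ρ'c) (sym (eq' c))))))
  ≈-actE {π = π} (≈hsusp ds#) (act-hsusp eq) (act-hsusp eq') =
    ≈hsusp (λ c ne → ds# c (λ ρc≡ρ'c → ne (trans (eq c) (trans (cong (π ∙ₐ_) ρc≡ρ'c) (sym (eq' c))))))

  ≈-actH : ∀ {∇ π h g h' g'} → ∇ ⊢ h ≈H g → ActH π h h' → ActH π g g' → ∇ ⊢ h' ≈H g'
  ≈-actH []       []         []           = []
  ≈-actH (d ∷ ds) (act ∷ as) (act' ∷ as') = ≈-actE d act act' ∷ ≈-actH ds as as'

≈-perm : ∀ {∇ h g} π → ∇ ⊢ h ≈H g → ∇ ⊢ permH π h ≈H permH π g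
≈-perm {h = h} {g} π d = ≈-actH d (act-permH π h) (act-permH π g)

ds-swap-⊆ : ∀ π π' {a c} → π ∙ₐ c ≢ swap (π ∙ₐ a) (π' ∙ₐ a) (π' ∙ₐ c) →
  c ≢ a × π ∙ₐ c ≢ π' ∙ₐ c
ds-swap-⊆ π π' {a} {c} ne with c ≟ a
... | yes refl = contradiction (sym (swap-right (π ∙ₐ c) (π' ∙ₐ c))) ne
... | no c≢a   = c≢a , λ πc≡π'c → ne (trans πc≡π'c (sym (swap-other
                   (λ π'c≡πa → ∙ₐ-preserves-≢ π c≢a (trans πc≡π'c π'c≡πa)) (∙ₐ-preserves-≢ π' c≢a))))

mutual
  ds-fresh⇒≈E : ∀ {∇ π π' e e₁ e₂} → (∀ c → π ∙ₐ c ≢ π' ∙ₐ c → FreshE ∇ c e) →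
    ActE π e e₁ → ActE π' e e₂ → ∇ ⊢ e₁ ≈E e₂
  ds-fresh⇒≈E {π = π} {π'} ds# (act-atom {a} refl) (act-atom refl) with π ∙ₐ a ≟ π' ∙ₐ a
  ... | yes πa≡π'a rewrite πa≡π'a = ≈atom
  ... | no πa≢π'a = contradiction refl (ds# a πa≢π'a)
  ds-fresh⇒≈E {∇} {π} {π'} ds# (act-isusp {ρ} {x = x} eq) (act-isusp eq') =
    ≈isusp (λ c ne → subst (λ d → (d , ivar x) ∈ ∇) (inv-inverseˡ ρ c)
      (ds# (ρ ∙ₐ c) (λ πρc≡π'ρc → ne (trans (eq c) (trans πρc≡π'ρc (sym (eq' c)))))))
  ds-fresh⇒≈E {∇} {π} {π'} ds# (act-hsusp {ρ} {X = X} eq) (act-hsusp eq') =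
    ≈hsusp (λ c ne → subst (λ d → (d , hvar X) ∈ ∇) (inv-inverseˡ ρ c)
      (ds# (ρ ∙ₐ c) (λ πρc≡π'ρc → ne (trans (eq c) (trans πρc≡π'ρc (sym (eq' c)))))))
  ds-fresh⇒≈E ds# (act-app act) (act-app act') = ≈app (ds-fresh⇒≈H ds# act act')
  ds-fresh⇒≈E {∇} {π} {π'} ds# (act-abs {a} {h = k} refl act) (act-abs refl act')
    with π ∙ₐ a ≟ π' ∙ₐ a
  ... | yes πa≡π'a rewrite πa≡π'a = ≈abs= (ds-fresh⇒≈H body-ds# act act')
    where
    body-ds# : ∀ c → π ∙ₐ c ≢ π' ∙ₐ c → FreshH ∇ c k
    body-ds# c ne = fresh-abs-body (λ c≡a → ne (subst (λ d → π ∙ₐ d ≡ π' ∙ₐ d) (sym c≡a) πa≡π'a)) (ds# c ne)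
  ... | no πa≢π'a =
    ≈abs (ds-fresh⇒≈H swapped-ds# act (act-∘H act' (act-permH _ _)))
         (inj₂ (πa≢π'a , subst (λ d → FreshH ∇ d _) π'c₀≡πa (fresh-actH c₀#k act')))
    where
    swapped-ds# : ∀ c → π ∙ₐ c ≢ swap (π ∙ₐ a) (π' ∙ₐ a) (π' ∙ₐ c) → FreshH ∇ c k
    swapped-ds# c ne = let c≢a , ne' = ds-swap-⊆ π π' ne in fresh-abs-body c≢a (ds# c ne')
    c₀ : Atom
    c₀ = inv π' ∙ₐ (π ∙ₐ a)
    π'c₀≡πa : π' ∙ₐ c₀ ≡ π ∙ₐ a
    π'c₀≡πa = inv-inverseʳ π' (π ∙ₐ a)
    c₀≢a : c₀ ≢ a
    c₀≢a c₀≡a = πa≢π'a (trans (sym π'c₀≡πa) (cong (π' ∙ₐ_) c₀≡a))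
    c₀#k : FreshH ∇ (inv π' ∙ₐ (π ∙ₐ a)) k
    c₀#k = fresh-abs-body c₀≢a (ds# c₀ (λ eq → c₀≢a (∙ₐ-injective π (trans eq π'c₀≡πa))))

  ds-fresh⇒≈H : ∀ {∇ π π' h h₁ h₂} → (∀ c → π ∙ₐ c ≢ π' ∙ₐ c → FreshH ∇ c h) →
    ActH π h h₁ → ActH π' h h₂ → ∇ ⊢ h₁ ≈H h₂
  ds-fresh⇒≈H ds# [] [] = []
  ds-fresh⇒≈H ds# (act ∷ as) (act' ∷ as') =
    ds-fresh⇒≈E (λ c ne → proj₁ (ds# c ne)) act act' ∷ ds-fresh⇒≈H (λ c ne → proj₂ (ds# c ne)) as as'

ds-transfer : ∀ {P : Atom → Set} π π' a → (∀ c → π ∙ₐ c ≢ π' ∙ₐ c → P c) →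
  P (inv π ∙ₐ a) → P (inv π' ∙ₐ a)
ds-transfer {P} π π' a ds⇒P P[π⁻¹a] with π ∙ₐ (inv π' ∙ₐ a) ≟ π' ∙ₐ (inv π' ∙ₐ a)
... | no ne = ds⇒P _ ne
... | yes eq = subst P (sym (inv-transpose π (trans eq (inv-inverseʳ π' a)))) P[π⁻¹a]

mutual
  ≈-preserves-freshE : ∀ {∇ a e e'} → ∇ ⊢ e ≈E e' → FreshE ∇ a e → FreshE ∇ a e'
  ≈-preserves-freshE ≈atom a#b = a#b
  ≈-preserves-freshE (≈app d) a#h = ≈-preserves-freshH d a#h
  ≈-preserves-freshE (≈abs= d) (inj₁ a≡b) = inj₁ a≡b
  ≈-preserves-freshE (≈abs= d) (inj₂ (a≢b , a#h)) = inj₂ (a≢b , ≈-preserves-freshH d a#h)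
  ≈-preserves-freshE {∇} {a} (≈abs {a'} {b} {h} {g} d a'#bg) a#a'h with a ≟ a' | a ≟ b
  ... | yes refl | _        = a'#bg
  ... | no _     | yes refl = inj₁ refl
  ... | no a≢a'  | no a≢b   = inj₂ (a≢b , subst (λ c → FreshH ∇ c g) (swap-other a≢a' a≢b)
                                (fresh-unpermH [ (a' , b) ] (≈-preserves-freshH d (fresh-abs-body a≢a' a#a'h))))
  ≈-preserves-freshE {∇} {a} (≈isusp {π} {π'} {x} ds#) = ds-transfer {λ c → (c , ivar x) ∈ ∇} π π' a ds#
  ≈-preserves-freshE {∇} {a} (≈hsusp {π} {π'} {X} ds#) = ds-transfer {λ c → (c , hvar X) ∈ ∇} π π' a ds#

  ≈-preserves-freshH : ∀ {∇ a h h'} → ∇ ⊢ h ≈H h' → FreshH ∇ a h → FreshH ∇ a h'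
  ≈-preserves-freshH [] _ = _
  ≈-preserves-freshH (d ∷ ds) (a#e , a#h) = ≈-preserves-freshE d a#e , ≈-preserves-freshH ds a#h

mutual
  ≈-reflects-freshE : ∀ {∇ a e e'} → ∇ ⊢ e ≈E e' → FreshE ∇ a e' → FreshE ∇ a e
  ≈-reflects-freshE ≈atom a#b = a#b
  ≈-reflects-freshE (≈app d) a#h = ≈-reflects-freshH d a#h
  ≈-reflects-freshE (≈abs= d) (inj₁ a≡b) = inj₁ a≡b
  ≈-reflects-freshE (≈abs= d) (inj₂ (a≢b , a#h)) = inj₂ (a≢b , ≈-reflects-freshH d a#h)
  ≈-reflects-freshE {∇} {a} (≈abs {a'} {b} {h} {g} d a'#bg) a#bg with a ≟ a'
  ... | yes a≡a' = inj₁ a≡a'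
  ... | no a≢a'  = inj₂ (a≢a' , ≈-reflects-freshH d a#[a'b]g)
    where
    a#[a'b]g : FreshH ∇ a (permH [ (a' , b) ] g)
    a#[a'b]g with a ≟ b
    ... | yes refl = subst (λ c → FreshH ∇ c (permH [ (a' , a) ] g)) (swap-left a' a)
                       (fresh-permH [ (a' , a) ] (fresh-abs-body (λ a'≡a → a≢a' (sym a'≡a)) a'#bg))
    ... | no a≢b   = subst (λ c → FreshH ∇ c _) (swap-other a≢a' a≢b)
                       (fresh-permH [ (a' , b) ] (fresh-abs-body a≢b a#bg))
  ≈-reflects-freshE {∇} {a} (≈isusp {π} {π'} {x} ds#) =
    ds-transfer {λ c → (c , ivar x) ∈ ∇} π' π a (λ c ne → ds# c (λ eq → ne (sym eq)))
  ≈-reflects-freshE {∇} {a} (≈hsusp {π} {π'} {X} ds#) =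
    ds-transfer {λ c → (c , hvar X) ∈ ∇} π' π a (λ c ne → ds# c (λ eq → ne (sym eq)))

  ≈-reflects-freshH : ∀ {∇ a h h'} → ∇ ⊢ h ≈H h' → FreshH ∇ a h' → FreshH ∇ a h
  ≈-reflects-freshH [] _ = _
  ≈-reflects-freshH (d ∷ ds) (a#e , a#h) = ≈-reflects-freshE d a#e , ≈-reflects-freshH ds a#h

-- Both rules for abstractions are instances of the second one, reading (a a) as the identity.
data AbsAlpha (∇ : Ctx) (a : Atom) (h : Hedge) : Elem → Set where
  abs-alpha : ∀ {b g g'} → ActH [ (a , b) ] g g' → ∇ ⊢ h ≈H g' → AbsAlpha ∇ a h (abs b g)

abs-alpha-view : ∀ {∇ a h e} → ∇ ⊢ abs a h ≈E e → AbsAlpha ∇ a h e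
abs-alpha-view {a = a} (≈abs= {h' = g} d) = abs-alpha (act-extH (λ c → sym (swap-self a c)) (act-idH g)) d
abs-alpha-view (≈abs {h' = g} d _) = abs-alpha (act-permH _ g) d

swap-swap-disagree : ∀ {a b c d} → swap a b (swap b c d) ≢ swap a c d → d ≢ c × (d ≡ a ⊎ d ≡ b)
swap-swap-disagree {a} {b} {c} {d} ne with d ≟ c
... | yes refl =
  contradiction (trans (cong (swap a b) (swap-right b d)) (trans (swap-right a b) (sym (swap-right a d)))) ne
... | no d≢c with d ≟ a | d ≟ b
...   | yes d≡a | _       = d≢c , inj₁ d≡a
...   | no _    | yes d≡b = d≢c , inj₂ d≡b
...   | no d≢a  | no d≢b  =
  contradiction (trans (cong (swap a b) (swap-other d≢b d≢c))
                       (trans (swap-other d≢a d≢b) (sym (swap-other d≢a d≢c)))) ne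

ds-trans : ∀ π₁ π₂ π₃ {P : Atom → Set} → (∀ c → π₁ ∙ₐ c ≢ π₂ ∙ₐ c → P c) →
  (∀ c → π₂ ∙ₐ c ≢ π₃ ∙ₐ c → P c) → ∀ c → π₁ ∙ₐ c ≢ π₃ ∙ₐ c → P c
ds-trans π₁ π₂ _ ds₁ ds₂ c ne with π₁ ∙ₐ c ≟ π₂ ∙ₐ c
... | no ne₁ = ds₁ c ne₁
... | yes eq = ds₂ c (λ eq' → ne (trans eq eq'))

mutual
  ≈-transE : ∀ {∇} e₁ {e₂ e₃} → ∇ ⊢ e₁ ≈E e₂ → ∇ ⊢ e₂ ≈E e₃ → ∇ ⊢ e₁ ≈E e₃
  ≈-transE (atom a) ≈atom ≈atom = ≈atom
  ≈-transE (app f h) (≈app d₁) (≈app d₂) = ≈app (≈-transH h d₁ d₂)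
  ≈-transE (isusp π x) (≈isusp {π' = π'} ds₁#) (≈isusp {π' = π''} ds₂#) =
    ≈isusp (ds-trans π π' π'' ds₁# ds₂#)
  ≈-transE (hsusp π X) (≈hsusp {π' = π'} ds₁#) (≈hsusp {π' = π''} ds₂#) =
    ≈hsusp (ds-trans π π' π'' ds₁# ds₂#)
  ≈-transE {∇} (abs a h) d₁ d₂ with abs-alpha-view d₁
  ... | abs-alpha {b} {g} act₁ h≈g' with abs-alpha-view d₂
  ...   | abs-alpha {c} {k} {k'} act₂ g≈k' =
    ≈abs (≈-transH h h≈[ab]k' (ds-fresh⇒≈H ds# (act-∘H act₂ (act-permH _ k')) (act-permH _ k))) a#ck
    where
    h≈[ab]k' : ∇ ⊢ h ≈H permH [ (a , b) ] k'
    h≈[ab]k' = ≈-transH h h≈g' (≈-actH g≈k' act₁ (act-permH _ k'))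
    a#ck : FreshE ∇ a (abs c k)
    a#ck = ≈-preserves-freshE d₂ (≈-preserves-freshE d₁ (inj₁ refl))
    b#ck : FreshE ∇ b (abs c k)
    b#ck = ≈-preserves-freshE d₂ (inj₁ refl)
    ds# : ∀ d → swap a b (swap b c d) ≢ swap a c d → FreshH ∇ d k
    ds# d ne with swap-swap-disagree {a} {b} {c} {d} ne
    ... | d≢c , inj₁ refl = fresh-abs-body d≢c a#ck
    ... | d≢c , inj₂ refl = fresh-abs-body d≢c b#ck

  ≈-transH : ∀ {∇} h₁ {h₂ h₃} → ∇ ⊢ h₁ ≈H h₂ → ∇ ⊢ h₂ ≈H h₃ → ∇ ⊢ h₁ ≈H h₃
  ≈-transH []      []       []       = []
  ≈-transH (e ∷ h) (d ∷ ds) (d' ∷ ds') = ≈-transE e d d' ∷ ≈-transH h ds ds'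

-- Substitutions

mutual
  permE-id : ∀ e → permE Id e ≡ e
  permE-id (atom a)    = refl
  permE-id (isusp π x) = refl
  permE-id (hsusp π X) = refl
  permE-id (abs a h)   = cong (abs a) (permH-id h)
  permE-id (app f h)   = cong (app f) (permH-id h)

  permH-id : ∀ h → permH Id h ≡ h
  permH-id []      = refl
  permH-id (e ∷ h) = cong₂ _∷_ (permE-id e) (permH-id h)

permH-++ : ∀ π h₁ h₂ → permH π (h₁ ++ h₂) ≡ permH π h₁ ++ permH π h₂
permH-++ π []       h₂ = refl
permH-++ π (e ∷ h₁) h₂ = cong (permE π e ∷_) (permH-++ π h₁ h₂)

mutual
  permE-∘ : ∀ π ρ e → permE π (permE ρ e) ≡ permE (π ++ ρ) e
  permE-∘ π ρ (atom a)    = cong atom (sym (∙ₐ-++ π ρ a))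
  permE-∘ π ρ (isusp κ x) = cong (λ κ' → isusp κ' x) (sym (++-assoc π ρ κ))
  permE-∘ π ρ (hsusp κ X) = cong (λ κ' → hsusp κ' X) (sym (++-assoc π ρ κ))
  permE-∘ π ρ (abs a h)   = cong₂ abs (sym (∙ₐ-++ π ρ a)) (permH-∘ π ρ h)
  permE-∘ π ρ (app f h)   = cong (app f) (permH-∘ π ρ h)

  permH-∘ : ∀ π ρ h → permH π (permH ρ h) ≡ permH (π ++ ρ) h
  permH-∘ π ρ []      = refl
  permH-∘ π ρ (e ∷ h) = cong₂ _∷_ (permE-∘ π ρ e) (permH-∘ π ρ h)

substSusp : Subst → Perm → HVar → Hedge
substSusp σ π X = maybe (permH π) [ hsusp π X ] (lookupH σ X)

substH-++ : ∀ τ h₁ h₂ → substH τ (h₁ ++ h₂) ≡ substH τ h₁ ++ substH τ h₂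
substH-++ τ []               h₂ = refl
substH-++ τ (atom a ∷ h₁)    h₂ = cong (_ ∷_) (substH-++ τ h₁ h₂)
substH-++ τ (isusp π x ∷ h₁) h₂ = cong (_ ∷_) (substH-++ τ h₁ h₂)
substH-++ τ (hsusp π X ∷ h₁) h₂ =
  trans (cong (substSusp τ π X ++_) (substH-++ τ h₁ h₂)) (sym (++-assoc (substSusp τ π X) _ _))
substH-++ τ (abs a g ∷ h₁)   h₂ = cong (_ ∷_) (substH-++ τ h₁ h₂)
substH-++ τ (app f g ∷ h₁)   h₂ = cong (_ ∷_) (substH-++ τ h₁ h₂)

mutual
  substI-permE : ∀ τ π e → substI τ (permE π e) ≡ permE π (substI τ e)
  substI-permE τ π (atom a) = refl
  substI-permE τ π (isusp κ x) with lookupI τ x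
  ... | just t  = sym (permE-∘ π κ t)
  ... | nothing = refl
  substI-permE τ π (hsusp κ X) = refl
  substI-permE τ π (abs a h) = cong (abs (π ∙ₐ a)) (substH-permH τ π h)
  substI-permE τ π (app f h) = cong (app f) (substH-permH τ π h)

  substH-permH : ∀ τ π h → substH τ (permH π h) ≡ permH π (substH τ h)
  substH-permH τ π [] = refl
  substH-permH τ π (atom a ∷ h) = cong (_ ∷_) (substH-permH τ π h)
  substH-permH τ π (isusp κ x ∷ h) = cong₂ _∷_ (substI-permE τ π (isusp κ x)) (substH-permH τ π h)
  substH-permH τ π (hsusp κ X ∷ h) =
    trans (cong₂ _++_ (substSusp-permH (lookupH τ X)) (substH-permH τ π h))
          (sym (permH-++ π (substSusp τ κ X) (substH τ h)))
    where
    substSusp-permH : ∀ m →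
      maybe (permH (π ++ κ)) [ hsusp (π ++ κ) X ] m ≡ permH π (maybe (permH κ) [ hsusp κ X ] m)
    substSusp-permH (just u) = sym (permH-∘ π κ u)
    substSusp-permH nothing  = refl
  substH-permH τ π (abs a g ∷ h) = cong₂ _∷_ (substI-permE τ π (abs a g)) (substH-permH τ π h)
  substH-permH τ π (app f g ∷ h) = cong₂ _∷_ (substI-permE τ π (app f g)) (substH-permH τ π h)

lookupI-indiv : ∀ {σ x t} → WellSorted σ → lookupI σ x ≡ just t → IsIndiv t
lookupI-indiv {(y ↦ᵢ u) ∷ σ} {x} (u-indiv ∷ ws) eq with y ≡ᵇ x
lookupI-indiv (u-indiv ∷ ws) refl | true  = u-indiv
lookupI-indiv (u-indiv ∷ ws) eq   | false = lookupI-indiv ws eq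
lookupI-indiv {(Y ↦ₕ u) ∷ σ} (_ ∷ ws) eq = lookupI-indiv ws eq

permE-indiv : ∀ π {t} → IsIndiv t → IsIndiv (permE π t)
permE-indiv π {atom a}    _ = tt
permE-indiv π {isusp κ x} _ = tt
permE-indiv π {abs a h}   _ = tt
permE-indiv π {app f h}   _ = tt

substI-indiv : ∀ {σ} → WellSorted σ → ∀ {t} → IsIndiv t → IsIndiv (substI σ t)
substI-indiv ws {atom a} _ = tt
substI-indiv {σ} ws {isusp κ x} _ with lookupI σ x in eq
... | just t  = permE-indiv κ (lookupI-indiv ws eq)
... | nothing = tt
substI-indiv ws {abs a h} _ = tt
substI-indiv ws {app f h} _ = tt

substH-∷-indiv : ∀ τ {t} h → IsIndiv t → substH τ (t ∷ h) ≡ substI τ t ∷ substH τ h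
substH-∷-indiv τ {atom a}    h _ = refl
substH-∷-indiv τ {isusp κ x} h _ = refl
substH-∷-indiv τ {abs a g}   h _ = refl
substH-∷-indiv τ {app f g}   h _ = refl

lookupI-∘ₛ : ∀ σ ρ x → lookupI (σ ∘ₛ ρ) x ≡ maybe (λ t → just (substI ρ t)) (lookupI ρ x) (lookupI σ x)
lookupI-∘ₛ []              ρ x = refl
lookupI-∘ₛ ((y ↦ᵢ t) ∷ σ) ρ x with y ≡ᵇ x
... | true  = refl
... | false = lookupI-∘ₛ σ ρ x
lookupI-∘ₛ ((Y ↦ₕ u) ∷ σ) ρ x = lookupI-∘ₛ σ ρ x

lookupH-∘ₛ : ∀ σ ρ X → lookupH (σ ∘ₛ ρ) X ≡ maybe (λ u → just (substH ρ u)) (lookupH ρ X) (lookupH σ X)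
lookupH-∘ₛ []              ρ X = refl
lookupH-∘ₛ ((y ↦ᵢ t) ∷ σ) ρ X = lookupH-∘ₛ σ ρ X
lookupH-∘ₛ ((Y ↦ₕ u) ∷ σ) ρ X with Y ≡ᵇ X
... | true  = refl
... | false = lookupH-∘ₛ σ ρ X

mutual
  substI-∘ₛ : ∀ {σ} ρ → WellSorted σ → ∀ e → substI (σ ∘ₛ ρ) e ≡ substI ρ (substI σ e)
  substI-∘ₛ ρ ws (atom a) = refl
  substI-∘ₛ {σ} ρ ws (isusp κ x) rewrite lookupI-∘ₛ σ ρ x with lookupI σ x
  ... | just t  = sym (substI-permE ρ κ t)
  ... | nothing = refl
  substI-∘ₛ ρ ws (hsusp κ X) = refl
  substI-∘ₛ ρ ws (abs a h) = cong (abs a) (substH-∘ₛ ρ ws h)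
  substI-∘ₛ ρ ws (app f h) = cong (app f) (substH-∘ₛ ρ ws h)

  substH-∘ₛ : ∀ {σ} ρ → WellSorted σ → ∀ h → substH (σ ∘ₛ ρ) h ≡ substH ρ (substH σ h)
  substH-∘ₛ ρ ws [] = refl
  substH-∘ₛ ρ ws (atom a ∷ h) = cong (_ ∷_) (substH-∘ₛ ρ ws h)
  substH-∘ₛ {σ} ρ ws (isusp κ x ∷ h) =
    trans (cong₂ _∷_ (substI-∘ₛ ρ ws (isusp κ x)) (substH-∘ₛ ρ ws h))
          (sym (substH-∷-indiv ρ (substH σ h) (substI-indiv ws {isusp κ x} tt)))
  substH-∘ₛ {σ} ρ ws (hsusp κ X ∷ h) =
    trans (cong₂ _++_ substSusp-∘ₛ (substH-∘ₛ ρ ws h)) (sym (substH-++ ρ (substSusp σ κ X) (substH σ h)))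
    where
    substSusp-∘ₛ : substSusp (σ ∘ₛ ρ) κ X ≡ substH ρ (substSusp σ κ X)
    substSusp-∘ₛ rewrite lookupH-∘ₛ σ ρ X with lookupH σ X
    ... | just u  = sym (substH-permH ρ κ u)
    ... | nothing = sym (++-identityʳ _)
  substH-∘ₛ ρ ws (abs a g ∷ h) = cong₂ _∷_ (substI-∘ₛ ρ ws (abs a g)) (substH-∘ₛ ρ ws h)
  substH-∘ₛ ρ ws (app f g ∷ h) = cong₂ _∷_ (substI-∘ₛ ρ ws (app f g)) (substH-∘ₛ ρ ws h)

WellSorted-∘ₛ : ∀ {σ ρ} → WellSorted σ → WellSorted ρ → WellSorted (σ ∘ₛ ρ)
WellSorted-∘ₛ {[]}            []                 wsρ = wsρ
WellSorted-∘ₛ {(x ↦ᵢ t) ∷ σ} (t-indiv ∷ wsσ) wsρ = substI-indiv wsρ t-indiv ∷ WellSorted-∘ₛ wsσ wsρ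
WellSorted-∘ₛ {(X ↦ₕ h) ∷ σ} (_ ∷ wsσ)       wsρ = tt ∷ WellSorted-∘ₛ wsσ wsρ

boundVar : Binding → Var
boundVar (x ↦ᵢ t) = ivar x
boundVar (X ↦ₕ h) = hvar X

boundValue : Binding → Hedge
boundValue (x ↦ᵢ t) = [ t ]
boundValue (X ↦ₕ h) = h

substH-boundVar : ∀ β σ → substH (β ∷ σ) (varTerm (boundVar β)) ≡ boundValue β
substH-boundVar (x ↦ᵢ t) σ rewrite ≡ᵇ-refl x = cong [_] (permE-id t)
substH-boundVar (X ↦ₕ h) σ rewrite ≡ᵇ-refl X = trans (++-identityʳ _) (permH-id h)

substH-unboundVar : ∀ β σ {χ} → χ ≢ boundVar β → substH (β ∷ σ) (varTerm χ) ≡ substH σ (varTerm χ)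
substH-unboundVar (x ↦ᵢ t) σ {ivar y} y≢x rewrite ≢⇒≡ᵇ-false (λ x≡y → y≢x (cong ivar (sym x≡y))) = refl
substH-unboundVar (x ↦ᵢ t) σ {hvar Y} _   = refl
substH-unboundVar (X ↦ₕ h) σ {ivar y} _   = refl
substH-unboundVar (X ↦ₕ h) σ {hvar Y} Y≢X rewrite ≢⇒≡ᵇ-false (λ X≡Y → Y≢X (cong hvar (sym X≡Y))) = refl

substH-varTerm-id : ∀ χ → substH idₛ (varTerm χ) ≡ varTerm χ
substH-varTerm-id (ivar x) = refl
substH-varTerm-id (hvar X) = refl

needsH-varTerm : ∀ a χ → needsH a (varTerm χ) ≡ [ (a , χ) ]
needsH-varTerm a (ivar x) = refl
needsH-varTerm a (hvar X) = refl

needsH-permH-varTerm : ∀ a π χ → needsH a (permH π (varTerm χ)) ≡ [ (inv π ∙ₐ a , χ) ]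
needsH-permH-varTerm a π (ivar x) rewrite ++-identityʳ π = refl
needsH-permH-varTerm a π (hvar X) rewrite ++-identityʳ π = refl

mutual
  needsE-⊆ : ∀ {∇ a} e → FreshE ∇ a e → needsE a e ⊆ ∇
  needsE-⊆ (isusp π x) a#x (here refl) = a#x
  needsE-⊆ (hsusp π X) a#X (here refl) = a#X
  needsE-⊆ {a = a} (abs b h) (inj₁ refl) c∈ rewrite ≡ᵇ-refl a with c∈
  ... | ()
  needsE-⊆ {a = a} (abs b h) (inj₂ (a≢b , a#h)) c∈ rewrite ≢⇒≡ᵇ-false a≢b = needsH-⊆ h a#h c∈
  needsE-⊆ (app f h) a#h c∈ = needsH-⊆ h a#h c∈

  needsH-⊆ : ∀ {∇ a} h → FreshH ∇ a h → needsH a h ⊆ ∇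
  needsH-⊆ (e ∷ h) (a#e , a#h) c∈ with ∈-++⁻ (needsE _ e) c∈
  ... | inj₁ c∈e = needsE-⊆ e a#e c∈e
  ... | inj₂ c∈h = needsH-⊆ h a#h c∈h

substH-bind-boundVar : ∀ β τ → WellSorted [ β ] →
  substH ([ β ] ∘ₛ τ) (varTerm (boundVar β)) ≡ substH τ (boundValue β)
substH-bind-boundVar β τ wsβ =
  trans (substH-∘ₛ τ wsβ (varTerm (boundVar β))) (cong (substH τ) (substH-boundVar β []))

substH-bind-unboundVar : ∀ β τ {χ} → WellSorted [ β ] → χ ≢ boundVar β →
  substH ([ β ] ∘ₛ τ) (varTerm χ) ≡ substH τ (varTerm χ)
substH-bind-unboundVar β τ {χ} wsβ χ≢β = begin
  substH ([ β ] ∘ₛ τ) (varTerm χ)      ≡⟨ substH-∘ₛ τ wsβ (varTerm χ) ⟩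
  substH τ (substH [ β ] (varTerm χ))  ≡⟨ cong (substH τ) (substH-unboundVar β [] χ≢β) ⟩
  substH τ (substH idₛ (varTerm χ))    ≡⟨ cong (substH τ) (substH-varTerm-id χ) ⟩
  substH τ (varTerm χ)                 ∎
  where open ≡-Reasoning

merBind-var : ∀ {χ₂ π χ₁ b} → MerBind χ₂ π χ₁ b → boundVar b ≡ χ₂
merBind-var mb-h = refl
merBind-var mb-i = refl

merBind-value : ∀ {χ₂ π χ₁ b} → MerBind χ₂ π χ₁ b → boundValue b ≡ permH π (varTerm χ₁)
merBind-value (mb-h {π = π} {ivar y}) = cong (λ π' → [ isusp π' y ]) (sym (++-identityʳ π))
merBind-value (mb-h {π = π} {hvar Y}) = cong (λ π' → [ hsusp π' Y ]) (sym (++-identityʳ π))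
merBind-value (mb-i {π = π} {y})      = cong (λ π' → [ isusp π' y ]) (sym (++-identityʳ π))

merBind-wellSorted : ∀ {χ₂ π χ₁ b} → MerBind χ₂ π χ₁ b → WellSorted [ b ]
merBind-wellSorted mb-h = tt ∷ []
merBind-wellSorted mb-i = tt ∷ []

∈-⟪⟫⁻ : ∀ {Γ σ c} → c ∈ Γ ⟪ σ ⟫ →
  Σ (Atom × Var) λ (a , χ) → (a , χ) ∈ Γ × c ∈ needsH a (substH σ (varTerm χ))
∈-⟪⟫⁻ {Γ} {σ} c∈ = find (∈-concatMap⁻ (λ (a , χ) → needsH a (substH σ (varTerm χ))) c∈)

-- A-basedness

∙ₐ-∈ : ∀ {A} π {a} → ABasedPerm A π → a ∈ A → π ∙ₐ a ∈ A
∙ₐ-∈ {A} π {a} π-based a∈A with π ∙ₐ a ≟ a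
... | yes πa≡a = subst (_∈ A) (sym πa≡a) a∈A
... | no πa≢a  = π-based (π ∙ₐ a) (λ ππa≡πa → πa≢a (∙ₐ-injective π ππa≡πa))

ABasedPerm-Id : ∀ {A} → ABasedPerm A Id
ABasedPerm-Id c c≢c = contradiction refl c≢c

ABasedPerm-swap : ∀ {A a b} → a ∈ A → b ∈ A → ABasedPerm A [ (a , b) ]
ABasedPerm-swap {a = a} {b} a∈A b∈A c moved with c ≟ a | c ≟ b
... | yes refl | _        = a∈A
... | no _     | yes refl = b∈A
... | no c≢a   | no c≢b   = contradiction (swap-other c≢a c≢b) moved

ABasedPerm-++ : ∀ {A} π ρ → ABasedPerm A π → ABasedPerm A ρ → ABasedPerm A (π ++ ρ)
ABasedPerm-++ π ρ π-based ρ-based c moved with ρ ∙ₐ c ≟ c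
... | no ρc≢c  = ρ-based c ρc≢c
... | yes ρc≡c = π-based c (λ πc≡c → moved (trans (∙ₐ-++ π ρ c) (trans (cong (π ∙ₐ_) ρc≡c) πc≡c)))

ABasedPerm-inv : ∀ {A} π → ABasedPerm A π → ABasedPerm A (inv π)
ABasedPerm-inv π π-based c moved with π ∙ₐ c ≟ c
... | no πc≢c  = π-based c πc≢c
... | yes πc≡c = contradiction (sym (inv-transpose π πc≡c)) moved

mutual
  ABasedE-permE : ∀ {A} π e → ABasedPerm A π → ABasedE A e → ABasedE A (permE π e)
  ABasedE-permE π (atom a)    π-based a∈A             = ∙ₐ-∈ π π-based a∈A
  ABasedE-permE π (isusp κ x) π-based κ-based         = ABasedPerm-++ π κ π-based κ-based
  ABasedE-permE π (hsusp κ X) π-based κ-based         = ABasedPerm-++ π κ π-based κ-based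
  ABasedE-permE π (abs a h)   π-based (a∈A , h-based) =
    ∙ₐ-∈ π π-based a∈A , ABasedH-permH π h π-based h-based
  ABasedE-permE π (app f h)   π-based h-based         = ABasedH-permH π h π-based h-based

  ABasedH-permH : ∀ {A} π h → ABasedPerm A π → ABasedH A h → ABasedH A (permH π h)
  ABasedH-permH π []      _       _                   = tt
  ABasedH-permH π (e ∷ h) π-based (e-based , h-based) =
    ABasedE-permE π e π-based e-based , ABasedH-permH π h π-based h-based

ABasedH-++ : ∀ {A} h₁ {h₂} → ABasedH A h₁ → ABasedH A h₂ → ABasedH A (h₁ ++ h₂)
ABasedH-++ []       _                    h₂-based = h₂-based
ABasedH-++ (e ∷ h₁) (e-based , h₁-based) h₂-based = e-based , ABasedH-++ h₁ h₁-based h₂-based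

ABasedH-++⁻ : ∀ {A} h₁ {h₂} → ABasedH A (h₁ ++ h₂) → ABasedH A h₁ × ABasedH A h₂
ABasedH-++⁻ []       h₂-based = tt , h₂-based
ABasedH-++⁻ (e ∷ h₁) (e-based , rest-based) =
  let h₁-based , h₂-based = ABasedH-++⁻ h₁ rest-based in (e-based , h₁-based) , h₂-based

ABasedBinding : List Atom → Binding → Set
ABasedBinding A β = ABasedH A (boundValue β)

lookupI-ABased : ∀ {A τ x t} → All (ABasedBinding A) τ → lookupI τ x ≡ just t → ABasedE A t
lookupI-ABased {τ = (y ↦ᵢ u) ∷ τ} {x} ((u-based , _) ∷ τ-based) eq with y ≡ᵇ x
lookupI-ABased ((u-based , _) ∷ τ-based) refl | true  = u-based
lookupI-ABased (_ ∷ τ-based)              eq   | false = lookupI-ABased τ-based eq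
lookupI-ABased {τ = (Y ↦ₕ u) ∷ τ} (_ ∷ τ-based) eq = lookupI-ABased τ-based eq

lookupH-ABased : ∀ {A τ X h} → All (ABasedBinding A) τ → lookupH τ X ≡ just h → ABasedH A h
lookupH-ABased {τ = (y ↦ᵢ t) ∷ τ} (_ ∷ τ-based) eq = lookupH-ABased τ-based eq
lookupH-ABased {τ = (Y ↦ₕ u) ∷ τ} {X} (u-based ∷ τ-based) eq with Y ≡ᵇ X
lookupH-ABased (u-based ∷ τ-based) refl | true  = u-based
lookupH-ABased (_ ∷ τ-based)       eq   | false = lookupH-ABased τ-based eq

mutual
  ABasedE-substI : ∀ {A τ} → All (ABasedBinding A) τ → ∀ e → ABasedE A e → ABasedE A (substI τ e)
  ABasedE-substI τ-based (atom a) a∈A = a∈A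
  ABasedE-substI {τ = τ} τ-based (isusp κ x) κ-based with lookupI τ x in eq
  ... | just t  = ABasedE-permE κ t κ-based (lookupI-ABased τ-based eq)
  ... | nothing = κ-based
  ABasedE-substI τ-based (hsusp κ X) κ-based = κ-based
  ABasedE-substI τ-based (abs a h) (a∈A , h-based) = a∈A , ABasedH-substH τ-based h h-based
  ABasedE-substI τ-based (app f h) h-based = ABasedH-substH τ-based h h-based

  ABasedH-substH : ∀ {A τ} → All (ABasedBinding A) τ → ∀ h → ABasedH A h → ABasedH A (substH τ h)
  ABasedH-substH τ-based [] _ = tt
  ABasedH-substH τ-based (atom a ∷ h) (a∈A , h-based) = a∈A , ABasedH-substH τ-based h h-based
  ABasedH-substH τ-based (isusp κ x ∷ h) (e-based , h-based) =
    ABasedE-substI τ-based (isusp κ x) e-based , ABasedH-substH τ-based h h-based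
  ABasedH-substH {τ = τ} τ-based (hsusp κ X ∷ h) (κ-based , h-based) =
    ABasedH-++ (substSusp τ κ X) susp-based (ABasedH-substH τ-based h h-based)
    where
    susp-based : ABasedH _ (substSusp τ κ X)
    susp-based with lookupH τ X in eq
    ... | just u  = ABasedH-permH κ u κ-based (lookupH-ABased τ-based eq)
    ... | nothing = κ-based , tt
  ABasedH-substH τ-based (abs a g ∷ h) (e-based , h-based) =
    ABasedE-substI τ-based (abs a g) e-based , ABasedH-substH τ-based h h-based
  ABasedH-substH τ-based (app f g ∷ h) (e-based , h-based) =
    ABasedE-substI τ-based (app f g) e-based , ABasedH-substH τ-based h h-based

merBind-ABased : ∀ {A χ₂ π χ₁ b} → MerBind χ₂ π χ₁ b → ABasedPerm A π → ABasedBinding A b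
merBind-ABased (mb-h {χ = ivar y}) π-based = π-based , tt
merBind-ABased (mb-h {χ = hvar Y}) π-based = π-based , tt
merBind-ABased mb-i                π-based = π-based , tt

-- The invariant of VNAU

_≟ᵥ_ : (χ χ' : Var) → Dec (χ ≡ χ')
ivar x ≟ᵥ ivar y with x ≟ y
... | yes refl = yes refl
... | no x≢y   = no (λ { refl → x≢y refl })
ivar x ≟ᵥ hvar Y = no (λ ())
hvar X ≟ᵥ ivar y = no (λ ())
hvar X ≟ᵥ hvar Y with X ≟ Y
... | yes refl = yes refl
... | no X≢Y   = no (λ { refl → X≢Y refl })

Distinct : AUP → AUP → Set
Distinct e e' = AUP.var e ≢ AUP.var e'

distinct-resp-↭ : ∀ {E E'} → E ↭ E' → AllPairs Distinct E → AllPairs Distinct E'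
distinct-resp-↭ E↭E' = AllPairs-resp-↭ (λ ne eq → ne (sym eq)) (resp₂ Distinct) (↭⇒↭ₛ E↭E')

fresh-apart : ∀ {∇ v} P S Γ σ → New ∇ (st P S Γ σ) v → All (λ e → v ≢ AUP.var e) (P ++ S)
fresh-apart P S Γ σ (v∉s , _) = All.tabulate (λ e∈ v≡e → v∉s (occurs e∈ v≡e))
  where
  occurs : ∀ {e v} → e ∈ P ++ S → v ≡ AUP.var e → v ∈ varsState (st P S Γ σ)
  occurs e∈ refl with ∈-++⁻ P e∈
  ... | inj₁ e∈P = ∈-++⁺ˡ (∈-concatMap⁺ varsAUP (Any.map (λ { refl → here refl }) e∈P))
  ... | inj₂ e∈S =
    ∈-++⁺ʳ (concatMap varsAUP P) (∈-++⁺ˡ (∈-concatMap⁺ varsAUP (Any.map (λ { refl → here refl }) e∈S)))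

data WellSortedAUP : AUP → Set where
  hedge-problem : ∀ {X l r} → WellSortedAUP (hvar X ∶ l ≜ r)
  term-problem  : ∀ {x t₁ t₂} → IsIndiv t₁ → IsIndiv t₂ → WellSortedAUP (ivar x ∶ [ t₁ ] ≜ [ t₂ ])

data Side : Set where
  left right : Side

side : Side → {T : Set} → T → T → T
side left  l r = l
side right l r = r

sideOf : Side → AUP → Hedge
sideOf s e = side s (AUP.lhs e) (AUP.rhs e)

≈-side-refl : ∀ {∇} s h → ∇ ⊢ h ≈H side s h h
≈-side-refl left  h = ≈-reflH h
≈-side-refl right h = ≈-reflH h

fresh-side : ∀ {∇ a l r} s → FreshH ∇ a l → FreshH ∇ a r → FreshH ∇ a (side s l r)
fresh-side left  a#l _   = a#l
fresh-side right _   a#r = a#r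

module Soundness (A : List Atom) (∇ : Ctx) (ℓ r : Hedge) (X₀ : HVar) where

  generalizer : Subst → Hedge
  generalizer σ = substH σ [ hsusp Id X₀ ]

  ABasedAUP : AUP → Set
  ABasedAUP e = ABasedH A (AUP.lhs e) × ABasedH A (AUP.rhs e)

  Instantiates : Side → Subst → AUP → Set
  Instantiates s τ e = ∇ ⊢ substH τ (varTerm (AUP.var e)) ≈H sideOf s e

  Generalizes : Side → List AUP → Subst → Set
  Generalizes s E σ = ∀ τ → All (Instantiates s τ) E → ∇ ⊢ substH τ (generalizer σ) ≈H side s ℓ r

  JustifiedBy : List AUP → Atom × Var → Set
  JustifiedBy S (a , χ) =
    a ∈ A × Σ AUP λ e → e ∈ S × AUP.var e ≡ χ × FreshH ∇ a (AUP.lhs e) × FreshH ∇ a (AUP.rhs e)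

  Justified : List AUP → Ctx → Set
  Justified S Γ = ∀ {c} → c ∈ Γ → JustifiedBy S c

  record Sound (E : List AUP) (σ : Subst) : Set where
    field
      distinct          : AllPairs Distinct E
      well-sorted-aups  : All WellSortedAUP E
      based-aups        : All ABasedAUP E
      based-generalizer : ABasedH A (generalizer σ)
      well-sorted       : WellSorted σ
      generalizes       : ∀ s → Generalizes s E σ

  record Invariant (s : State) : Set where
    field
      sound     : Sound (State.P s ++ State.S s) (State.σ s)
      justified : Justified (State.S s) (State.Γ s)

  sound-resp-↭ : ∀ {E E' σ} → E ↭ E' → Sound E σ → Sound E' σ
  sound-resp-↭ E↭E' snd = record
    { distinct          = distinct-resp-↭ E↭E' distinct
    ; well-sorted-aups  = All-resp-↭ E↭E' well-sorted-aups
    ; based-aups        = All-resp-↭ E↭E' based-aups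
    ; based-generalizer = based-generalizer
    ; well-sorted       = well-sorted
    ; generalizes       = λ s τ inst → generalizes s τ (All-resp-↭ (↭-sym E↭E') inst)
    }
    where open Sound snd

  generalizer-bind : ∀ {σ} β τ → WellSorted σ → WellSorted [ β ] →
    substH ([ β ] ∘ₛ τ) (generalizer σ) ≡ substH τ (generalizer (σ ∘ₛ [ β ]))
  generalizer-bind {σ} β τ wsσ wsβ = begin
    substH ([ β ] ∘ₛ τ) (generalizer σ)
      ≡⟨ substH-∘ₛ τ wsβ (generalizer σ) ⟩
    substH τ (substH [ β ] (generalizer σ))
      ≡⟨ cong (substH τ) (sym (substH-∘ₛ [ β ] wsσ [ hsusp Id X₀ ])) ⟩
    substH τ (generalizer (σ ∘ₛ [ β ])) ∎
    where open ≡-Reasoning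

  -- Every rule that extends σ replaces a problem e₀ by the problems new and binds its variable.
  sound-bind : ∀ {E R σ} e₀ β new → Sound E σ → E ↭ e₀ ∷ R → AUP.var e₀ ≡ boundVar β →
    WellSorted [ β ] → ABasedBinding A β →
    AllPairs Distinct new → All (λ e → All (Distinct e) R) new →
    All WellSortedAUP new → All ABasedAUP new →
    (∀ s τ → All (Instantiates s τ) (new ++ R) → ∇ ⊢ substH τ (boundValue β) ≈H sideOf s e₀) →
    Sound (new ++ R) (σ ∘ₛ [ β ])
  sound-bind {E} {R} {σ} e₀ β new snd E↭ e₀≡β wsβ β-based
             new-distinct new-apart new-ws new-based instantiate-β = record
    { distinct          = AllPairsₚ.++⁺ new-distinct (AllPairs.tail distinct₀) new-apart
    ; well-sorted-aups  = Allₚ.++⁺ new-ws (All.tail (All-resp-↭ E↭ well-sorted-aups))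
    ; based-aups        = Allₚ.++⁺ new-based (All.tail (All-resp-↭ E↭ based-aups))
    ; based-generalizer = subst (ABasedH A) (sym (substH-∘ₛ [ β ] well-sorted [ hsusp Id X₀ ]))
                            (ABasedH-substH (β-based ∷ []) (generalizer σ) based-generalizer)
    ; well-sorted       = WellSorted-∘ₛ well-sorted wsβ
    ; generalizes       = generalizes-bound
    }
    where
    open Sound snd
    distinct₀ : AllPairs Distinct (e₀ ∷ R)
    distinct₀ = distinct-resp-↭ E↭ distinct
    generalizes-bound : ∀ s → Generalizes s (new ++ R) (σ ∘ₛ [ β ])
    generalizes-bound s τ inst = subst (λ u → ∇ ⊢ u ≈H side s ℓ r) (generalizer-bind β τ well-sorted wsβ)
                                   (generalizes s ([ β ] ∘ₛ τ) (All-resp-↭ (↭-sym E↭) (inst₀ ∷ inst-R)))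
      where
      inst₀ : Instantiates s ([ β ] ∘ₛ τ) e₀
      inst₀ rewrite e₀≡β | substH-bind-boundVar β τ wsβ = instantiate-β s τ inst
      inst-R : All (Instantiates s ([ β ] ∘ₛ τ)) R
      inst-R = All.zipWith
        (λ { (e₀≢e , inst-e) → subst (λ u → ∇ ⊢ u ≈H _)
               (sym (substH-bind-unboundVar β τ wsβ (λ e≡β → e₀≢e (trans e₀≡β (sym e≡β))))) inst-e })
        (AllPairs.head distinct₀ , Allₚ.++⁻ʳ new inst)

  -- The rules Tri, Dec and Abs.
  invariant-expand : ∀ {P P' S Γ σ X l q} new h → Invariant (st P S Γ σ) → P ↭ (hvar X ∶ l ≜ q) ∷ P' →
    AllPairs Distinct new → All (λ e → All (Distinct e) (P ++ S)) new → All WellSortedAUP new →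
    (ABasedH A l × ABasedH A q → ABasedH A h × All ABasedAUP new) →
    (∀ s τ → All (Instantiates s τ) new → ∇ ⊢ substH τ h ≈H side s l q) →
    Invariant (st (new ++ P') S Γ (σ ∘ₛ [ X ↦ₕ h ]))
  invariant-expand {P} {P'} {S} {X = X} {l} {q} new h I P↭ new-distinct new-apart new-ws based instantiate = record
    { sound     = subst (λ E → Sound E _) (sym (++-assoc new P' S))
                    (sound-bind _ (X ↦ₕ h) new sound E↭ refl (tt ∷ []) (proj₁ based')
                      new-distinct (All.map (λ apart → All.tail (All-resp-↭ E↭ apart)) new-apart)
                      new-ws (proj₂ based') (λ s τ inst → instantiate s τ (Allₚ.++⁻ˡ new inst)))
    ; justified = justified
    }
    where
    open Invariant I
    E↭ : P ++ S ↭ (hvar X ∶ l ≜ q) ∷ P' ++ S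
    E↭ = ++⁺ʳ S P↭
    based' : ABasedH A h × All ABasedAUP new
    based' = based (All.head (All-resp-↭ E↭ (Sound.based-aups sound)))

  invariant-sol : ∀ {P P' S Γ Γ' σ X l q} → Invariant (st P S Γ σ) → P ↭ (hvar X ∶ l ≜ q) ∷ P' →
    SolCtx A ∇ X l q Γ Γ' → Invariant (st P' ((hvar X ∶ l ≜ q) ∷ S) Γ' σ)
  invariant-sol {P' = P'} {S} {Γ' = Γ'} {X = X} {l} {q} I P↭ sol = record
    { sound     = sound-resp-↭ (↭-trans (++⁺ʳ S P↭) (↭-sym (shift _ P' S))) sound
    ; justified = justified-sol
    }
    where
    open Invariant I
    justified-sol : Justified ((hvar X ∶ l ≜ q) ∷ S) Γ'
    justified-sol {c} c∈Γ' with proj₁ (sol c) c∈Γ'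
    ... | inj₁ c∈Γ =
      let a∈A , e , e∈S , justification = justified c∈Γ in a∈A , e , there e∈S , justification
    ... | inj₂ (a , refl , a∈A , a#l , a#q) = a∈A , _ , here refl , refl , a#l , a#q

  -- The rules Mer and Nar: constraints on the variable of e₀ become those produced by β.
  justified-bind : ∀ {S S' S'' Γ} e₀ β → Justified S Γ → S ↭ e₀ ∷ S' → All (Distinct e₀) S' →
    AUP.var e₀ ≡ boundVar β → (∀ {e} → e ∈ S' → e ∈ S'') →
    (∀ {a} → a ∈ A → FreshH ∇ a (AUP.lhs e₀) → FreshH ∇ a (AUP.rhs e₀) →
       ∀ {c} → c ∈ needsH a (boundValue β) → JustifiedBy S'' c) →
    Justified S'' (Γ ⟪ [ β ] ⟫)
  justified-bind e₀ β justified S↭ e₀-apart e₀≡β S'⊆S'' justify-β c∈ with ∈-⟪⟫⁻ c∈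
  ... | (a , χ) , aχ∈Γ , c∈needs with justified aχ∈Γ
  ...   | a∈A , e , e∈S , refl , a#l , a#r with AUP.var e ≟ᵥ boundVar β | ∈-resp-↭ S↭ e∈S
  ...     | yes e≡β | here refl =
    justify-β a∈A a#l a#r (subst (λ u → _ ∈ needsH a u)
      (trans (cong (λ χ → substH [ β ] (varTerm χ)) e≡β) (substH-boundVar β [])) c∈needs)
  ...     | yes e≡β | there e∈S' = contradiction (trans e₀≡β (sym e≡β)) (All.lookup e₀-apart e∈S')
  ...     | no e≢β  | here refl  = contradiction e₀≡β e≢β
  ...     | no e≢β  | there e∈S'
    rewrite substH-unboundVar β [] e≢β | substH-varTerm-id (AUP.var e) | needsH-varTerm a (AUP.var e) with c∈needs
  ...       | here refl = a∈A , e , S'⊆S'' e∈S' , refl , a#l , a#r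

  invariant-mer : ∀ {χ₁ χ₂ ℓ₁ r₁ ℓ₂ r₂ π b P S S' Γ σ} → Invariant (st P S Γ σ) →
    S ↭ (χ₁ ∶ ℓ₁ ≜ r₁) ∷ (χ₂ ∶ ℓ₂ ≜ r₂) ∷ S' → ABasedPerm A π →
    ∇ ⊢ permH π ℓ₁ ≈H ℓ₂ → ∇ ⊢ permH π r₁ ≈H r₂ → MerBind χ₂ π χ₁ b →
    Invariant (st P ((χ₁ ∶ ℓ₁ ≜ r₁) ∷ S') (Γ ⟪ [ b ] ⟫) (σ ∘ₛ [ b ]))
  invariant-mer {χ₁} {χ₂} {ℓ₁} {r₁} {ℓ₂} {r₂} {π} {b} {P} {S} {S'}
                I S↭ π-based πℓ₁≈ℓ₂ πr₁≈r₂ mb = record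
    { sound     = sound-bind e₂ b [] sound E↭ (sym (merBind-var mb)) (merBind-wellSorted mb)
                    (merBind-ABased mb π-based) [] [] [] [] instantiate
    ; justified = justified-bind e₂ b justified S↭₂
                    (Allₚ.++⁻ʳ P (AllPairs.head (distinct-resp-↭ E↭ (Sound.distinct sound))))
                    (sym (merBind-var mb)) (λ e∈ → e∈) justify
    }
    where
    open Invariant I
    e₁ e₂ : AUP
    e₁ = χ₁ ∶ ℓ₁ ≜ r₁
    e₂ = χ₂ ∶ ℓ₂ ≜ r₂
    S↭₂ : S ↭ e₂ ∷ e₁ ∷ S'
    S↭₂ = ↭-trans S↭ (↭-swap e₁ e₂ ↭-refl)
    E↭ : P ++ S ↭ e₂ ∷ P ++ e₁ ∷ S'
    E↭ = ↭-trans (++⁺ˡ P S↭₂) (shift e₂ P (e₁ ∷ S'))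
    merged : ∀ s → ∇ ⊢ permH π (sideOf s e₁) ≈H sideOf s e₂
    merged left  = πℓ₁≈ℓ₂
    merged right = πr₁≈r₂
    instantiate : ∀ s τ → All (Instantiates s τ) (P ++ e₁ ∷ S') →
      ∇ ⊢ substH τ (boundValue b) ≈H sideOf s e₂
    instantiate s τ inst rewrite merBind-value mb | substH-permH τ π (varTerm χ₁) =
      ≈-transH (permH π (substH τ (varTerm χ₁)))
        (≈-perm π (All.lookup inst (∈-++⁺ʳ P (here refl)))) (merged s)
    justify : ∀ {a} → a ∈ A → FreshH ∇ a ℓ₂ → FreshH ∇ a r₂ →
      ∀ {c} → c ∈ needsH a (boundValue b) → JustifiedBy (e₁ ∷ S') c
    justify {a} a∈A a#ℓ₂ a#r₂ c∈ rewrite merBind-value mb | needsH-permH-varTerm a π χ₁ with c∈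
    ... | here refl =
      ∙ₐ-∈ (inv π) (ABasedPerm-inv π π-based) a∈A , e₁ , here refl , refl ,
      fresh-unpermH π (≈-reflects-freshH πℓ₁≈ℓ₂ a#ℓ₂) , fresh-unpermH π (≈-reflects-freshH πr₁≈r₂ a#r₂)

  invariant-nar : ∀ {X t₁ t₂ x P S S' Γ σ} → Invariant (st P S Γ σ) →
    S ↭ (hvar X ∶ [ t₁ ] ≜ [ t₂ ]) ∷ S' → IsIndiv t₁ → IsIndiv t₂ → New ∇ (st P S Γ σ) (ivar x) →
    Invariant (st P ((ivar x ∶ [ t₁ ] ≜ [ t₂ ]) ∷ S') (Γ ⟪ [ X ↦ₕ [ isusp Id x ] ] ⟫)
                  (σ ∘ₛ [ X ↦ₕ [ isusp Id x ] ]))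
  invariant-nar {X} {t₁} {t₂} {x} {P} {S} {S'} {Γ} {σ} I S↭ t₁-indiv t₂-indiv new = record
    { sound     = sound-resp-↭ (↭-sym (shift e₁ P S'))
                    (sound-bind e₀ (X ↦ₕ [ isusp Id x ]) [ e₁ ] sound E↭ refl (tt ∷ []) (ABasedPerm-Id , tt)
                      ([] ∷ []) (All.tail (All-resp-↭ E↭ (fresh-apart P S Γ σ new)) ∷ [])
                      (term-problem t₁-indiv t₂-indiv ∷ [])
                      (All.head (All-resp-↭ E↭ (Sound.based-aups sound)) ∷ [])
                      (λ { s τ (inst ∷ _) → inst }))
    ; justified = justified-bind e₀ (X ↦ₕ [ isusp Id x ]) justified S↭
                    (Allₚ.++⁻ʳ P (AllPairs.head (distinct-resp-↭ E↭ (Sound.distinct sound)))) refl there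
                    (λ { a∈A a#t₁ a#t₂ (here refl) → a∈A , e₁ , here refl , refl , a#t₁ , a#t₂ })
    }
    where
    open Invariant I
    e₀ e₁ : AUP
    e₀ = hvar X ∶ [ t₁ ] ≜ [ t₂ ]
    e₁ = ivar x ∶ [ t₁ ] ≜ [ t₂ ]
    E↭ : P ++ S ↭ e₀ ∷ P ++ S'
    E↭ = ↭-trans (++⁺ˡ P S↭) (shift e₀ P S')

  invariant-step : ∀ {s s'} → Invariant s → Step A ∇ s s' → Invariant s'
  invariant-step I (tri-T {a = a} P↭) =
    invariant-expand [] [ atom a ] I P↭ [] [] [] (λ (l-based , _) → l-based , []) (λ s _ _ → ≈-side-refl s _)
  invariant-step I (tri-H P↭) =
    invariant-expand [] [] I P↭ [] [] [] (λ _ → tt , []) (λ s _ _ → ≈-side-refl s [])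
  invariant-step {st P S Γ σ} I (dec-T {f = f} {s₁} {q} {Y} P↭ new) =
    invariant-expand [ hvar Y ∶ s₁ ≜ q ] [ app f [ hsusp Id Y ] ] I P↭ ([] ∷ []) (fresh-apart P S Γ σ new ∷ [])
      (hedge-problem ∷ [])
      (λ { ((s₁-based , _) , (q-based , _)) → ((ABasedPerm-Id , tt) , tt) , (s₁-based , q-based) ∷ [] })
      (λ { left  τ (inst ∷ []) → ≈app inst ∷ []
         ; right τ (inst ∷ []) → ≈app inst ∷ [] })
  invariant-step {st P S Γ σ} I (dec-H {s₁ = s₁} {s₂} {q₁} {q₂} {Y₁} {Y₂} P↭ _ _ new₁ new₂ Y₁≢Y₂) =
    invariant-expand (hvar Y₁ ∶ s₁ ≜ q₁ ∷ hvar Y₂ ∶ s₂ ≜ q₂ ∷ []) (hsusp Id Y₁ ∷ hsusp Id Y₂ ∷ [])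
      I P↭
      (((λ { refl → Y₁≢Y₂ refl }) ∷ []) ∷ [] ∷ [])
      (fresh-apart P S Γ σ new₁ ∷ fresh-apart P S Γ σ new₂ ∷ [])
      (hedge-problem ∷ hedge-problem ∷ [])
      (λ (l-based , q-based) →
         let s₁-based , s₂-based = ABasedH-++⁻ s₁ l-based
             q₁-based , q₂-based = ABasedH-++⁻ q₁ q-based
         in (ABasedPerm-Id , ABasedPerm-Id , tt) , (s₁-based , q₁-based) ∷ (s₂-based , q₂-based) ∷ [])
      (λ { left  τ (inst₁ ∷ inst₂ ∷ []) → ≈-pair τ inst₁ inst₂
         ; right τ (inst₁ ∷ inst₂ ∷ []) → ≈-pair τ inst₁ inst₂ })
    where
    ≈-pair : ∀ τ {h₁ h₂} → ∇ ⊢ substH τ [ hsusp Id Y₁ ] ≈H h₁ → ∇ ⊢ substH τ [ hsusp Id Y₂ ] ≈H h₂ →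
      ∇ ⊢ substH τ (hsusp Id Y₁ ∷ hsusp Id Y₂ ∷ []) ≈H (h₁ ++ h₂)
    ≈-pair τ inst₁ inst₂ =
      subst (λ u → ∇ ⊢ u ≈H _) (sym (substH-++ τ [ hsusp Id Y₁ ] [ hsusp Id Y₂ ])) (≈-++ inst₁ inst₂)
  invariant-step {st P S Γ σ} I (abs-T {a = a} {b} {t₁} {t₂} {c} {Y} P↭ c∈A c#at₁ c#bt₂ new) =
    invariant-expand [ hvar Y ∶ permH [ (c , a) ] t₁ ≜ permH [ (c , b) ] t₂ ] [ abs c [ hsusp Id Y ] ] I P↭
      ([] ∷ []) (fresh-apart P S Γ σ new ∷ []) (hedge-problem ∷ [])
      (λ { (((a∈A , t₁-based) , _) , ((b∈A , t₂-based) , _)) →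
             ((c∈A , (ABasedPerm-Id , tt)) , tt) ,
             (ABasedH-permH _ t₁ (ABasedPerm-swap c∈A a∈A) t₁-based ,
              ABasedH-permH _ t₂ (ABasedPerm-swap c∈A b∈A) t₂-based) ∷ [] })
      (λ { left  τ (inst ∷ []) → ≈abs inst c#at₁ ∷ []
         ; right τ (inst ∷ []) → ≈abs inst c#bt₂ ∷ [] })
  invariant-step I (sol-T P↭ _ sol) = invariant-sol I P↭ sol
  invariant-step I (sol-H P↭ _ sol) = invariant-sol I P↭ sol
  invariant-step I (mer S↭ π-based πℓ₁≈ℓ₂ πr₁≈r₂ mb) = invariant-mer I S↭ π-based πℓ₁≈ℓ₂ πr₁≈r₂ mb
  invariant-step I (nar-T S↭ t₁-indiv t₂-indiv new) = invariant-nar I S↭ t₁-indiv t₂-indiv new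

  invariant-⟹⁺ : ∀ {s s'} → Invariant s → s ⟹⁺[ A , ∇ ] s' → Invariant s'
  invariant-⟹⁺ I Plus.[ step ]      = invariant-step I step
  invariant-⟹⁺ I (step Plus.∷ steps) = invariant-⟹⁺ (invariant-step I step) steps

  invariant-initial : ABasedH A ℓ → ABasedH A r → Invariant (st [ hvar X₀ ∶ ℓ ≜ r ] [] [] idₛ)
  invariant-initial ℓ-based r-based = record
    { sound = record
      { distinct          = [] ∷ []
      ; well-sorted-aups  = hedge-problem ∷ []
      ; based-aups        = (ℓ-based , r-based) ∷ []
      ; based-generalizer = ABasedPerm-Id , tt
      ; well-sorted       = []
      ; generalizes       = λ { s τ (inst ∷ []) → inst }
      }
    ; justified = λ ()
    }

  instanceBinding : Side → ∀ e → WellSortedAUP e → Binding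
  instanceBinding s _ (hedge-problem {X} {l} {q})    = X ↦ₕ side s l q
  instanceBinding s _ (term-problem {x} {t₁} {t₂} _ _) = x ↦ᵢ side s t₁ t₂

  instantiation : Side → ∀ E → All WellSortedAUP E → Subst
  instantiation s []      []         = []
  instantiation s (e ∷ E) (ws ∷ wss) = instanceBinding s e ws ∷ instantiation s E wss

  instantiation-wellSorted : ∀ s E wss → WellSorted (instantiation s E wss)
  instantiation-wellSorted s [] [] = []
  instantiation-wellSorted s (e ∷ E) (hedge-problem ∷ wss) = tt ∷ instantiation-wellSorted s E wss
  instantiation-wellSorted left  (e ∷ E) (term-problem t₁-indiv _ ∷ wss) =
    t₁-indiv ∷ instantiation-wellSorted left E wss
  instantiation-wellSorted right (e ∷ E) (term-problem _ t₂-indiv ∷ wss) =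
    t₂-indiv ∷ instantiation-wellSorted right E wss

  instanceBinding-var : ∀ s e ws → boundVar (instanceBinding s e ws) ≡ AUP.var e
  instanceBinding-var s _ hedge-problem      = refl
  instanceBinding-var s _ (term-problem _ _) = refl

  instanceBinding-value : ∀ s e ws → boundValue (instanceBinding s e ws) ≡ sideOf s e
  instanceBinding-value s     _ hedge-problem      = refl
  instanceBinding-value left  _ (term-problem _ _) = refl
  instanceBinding-value right _ (term-problem _ _) = refl

  instantiation-instantiates : ∀ s E wss → AllPairs Distinct E → ∀ {e} → e ∈ E →
    substH (instantiation s E wss) (varTerm (AUP.var e)) ≡ sideOf s e
  instantiation-instantiates s (e ∷ E) (ws ∷ wss) _ (here refl) = begin
    substH (instanceBinding s e ws ∷ _) (varTerm (AUP.var e))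
      ≡⟨ cong (λ χ → substH (instanceBinding s e ws ∷ _) (varTerm χ)) (sym (instanceBinding-var s e ws)) ⟩
    substH (instanceBinding s e ws ∷ _) (varTerm (boundVar (instanceBinding s e ws)))
      ≡⟨ substH-boundVar (instanceBinding s e ws) _ ⟩
    boundValue (instanceBinding s e ws)
      ≡⟨ instanceBinding-value s e ws ⟩
    sideOf s e ∎
    where open ≡-Reasoning
  instantiation-instantiates s (e' ∷ E) (ws ∷ wss) (e'-apart ∷ distinct) (there e∈E) =
    trans (substH-unboundVar (instanceBinding s e' ws) _
             (λ e≡e' → All.lookup e'-apart e∈E (sym (trans e≡e' (instanceBinding-var s e' ws)))))
          (instantiation-instantiates s E wss distinct e∈E)

  moreGeneral : ∀ {S Γ σ} s → Invariant (st [] S Γ σ) → MoreGeneral Γ (generalizer σ) ∇ (side s ℓ r)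
  moreGeneral {S} {Γ} s I =
    τ , instantiation-wellSorted s S well-sorted-aups , (∇ , τ-fresh) ,
    (λ c∈ → let (a , χ) , aχ∈Γ , c∈needs = ∈-⟪⟫⁻ c∈ in needsH-⊆ _ (τ-fresh (a , χ) aχ∈Γ) c∈needs) ,
    generalizes s τ (All.tabulate (λ {e} e∈S →
      subst (λ u → ∇ ⊢ u ≈H sideOf s e) (sym (instantiates e∈S)) (≈-reflH (sideOf s e))))
    where
    open Invariant I
    open Sound sound
    τ : Subst
    τ = instantiation s S well-sorted-aups
    instantiates : ∀ {e} → e ∈ S → substH τ (varTerm (AUP.var e)) ≡ sideOf s e
    instantiates = instantiation-instantiates s S well-sorted-aups distinct
    τ-fresh : ∀ c → c ∈ Γ → FreshH ∇ (proj₁ c) (substH τ (varTerm (proj₂ c)))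
    τ-fresh (a , χ) aχ∈Γ with justified aχ∈Γ
    ... | _ , e , e∈S , refl , a#l , a#r rewrite instantiates e∈S = fresh-side s a#l a#r

  generalization : ∀ {S Γ σ} → Invariant (st [] S Γ σ) → IsABasedGeneralization A Γ (generalizer σ) ∇ ℓ ∇ r
  generalization I =
    All.tabulate (λ c∈Γ → proj₁ (Invariant.justified I c∈Γ)) ,
    Sound.based-generalizer (Invariant.sound I) ,
    moreGeneral left I ,
    moreGeneral right I

theorem2 : (A : List Atom) (∇ : Ctx) (ℓ r : Hedge) (X : HVar) →
    WFH ℓ → WFH r →
    ABasedH A ℓ → ABasedH A r → ABasedCtx A ∇ →
    hvar X ∉ varsH ℓ → hvar X ∉ varsH r → hvar X ∉ varsCtx ∇ →
    ∀ {S Γ σ} →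
    st [ hvar X ∶ ℓ ≜ r ] [] [] idₛ ⟹⁺[ A , ∇ ] st [] S Γ σ →
    IsABasedGeneralization A Γ (substH σ [ hsusp Id X ]) ∇ ℓ ∇ r
theorem2 A ∇ ℓ r X _ _ ℓ-based r-based _ _ _ _ derivation =
  generalization (invariant-⟹⁺ (invariant-initial ℓ-based r-based) derivation)
  where open Soundness A ∇ ℓ r X
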